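{- Let $d,\mu$ be natural numbers with $3\le d\le\mu$. Then the map $$\Psi_d^{\mu}:\mathfrak{Irr}_d^{\mu}\to\mathfrak P_d\cap\mathbb Z^{2d-3},\quad(\mathcal D,d)\mapsto(c_1(X),\dots,c_{d-2}(X),c_1(Y),\dots,c_{d-2}(Y),b-a),$$ where $(\mathcal D,d)$ is in $(a,b)$-standard form, $X=X(\mathcal D,d)$ and $Y=Y(\mathcal D,d)$, is a bijection.
   Context: $\mathbb N=\{1,2,\dots\}$, $[n]=\{1,\dots,n\}$. A Ferrers diagram is a finite set $\mathcal D\subseteq\mathbb N^2$ such that $(x,y)\in\mathcal D$ implies $(i,j)\in\mathcal D$ for all $i\in[x]$, $j\in[y]$ (row, column); order $n$ means $\mathcal D\subseteq[n]^2$. For $0\le j\le d-1$, $\nu_j(\mathcal D,d)=|\{(x,y)\in\mathcal D: x\ge d-j,\ y\ge j+1\}|$, $\nu_{\min}=\min_j\nu_j$. For $P\in\mathcal D$ with $\mathcal D'=\mathcal D\setminus\{P\}$ a Ferrers diagram: if $\nu_{\min}(\mathcal D',d)=\nu_{\min}(\mathcal D,d)$ write $\mathcal D'\xrightarrow{d}\mathcal D$, else $\mathcal D\xrightarrow{d}\mathcal D'$. $(\mathcal D,d)$ is irreducible if there is no Ferrers diagram $\mathcal D'$ with $\mathcal D'\xrightarrow{d}\mathcal D$. For $\mathcal D$ of order $n$ and integers $a,b\ge d-1$, $(\mathcal D,d)$ is in $(a,b)$-standard form if $\mathcal D\cap\{d-1,\dots,n\}^2=\{d-1,\dots,a\}\times\{d-1,\dots,b\}$;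 then $X(\mathcal D,d)=\{(y,x):(x,y)\in\mathcal D,\ x\in[d-2],\ y\ge b+1\}$, $Y(\mathcal D,d)=\{(x,y)\in\mathcal D:x\ge a+1,\ y\in[d-2]\}$, $c_i(Z)=|Z\cap(\mathbb N\times\{i\})|$. $\mathfrak{Irr}_d^{\mu}$ is the set of irreducible pairs $(\mathcal D,d)$ that are in $(a,b)$-standard form for some $(a,b)\in\mathbb N^2$ with $\min(a,b)=\mu$. $\mathfrak P_d\subseteq\mathbb R^{2d-3}$ is the set of $(x_1,\dots,x_{d-2},y_1,\dots,y_{d-2},z)$ with: $x_j\ge x_{j+1}$, $y_j\ge y_{j+1}$ for $j\in[d-3]$; $x_j,y_j\ge0$ for $j\in[d-2]$; $j(z+d-1-j)+\sum_{i=0}^{j-2}x_{d-2-i}-\sum_{i=1}^{j}y_i\ge0$ for $j\in[d-2]$; $\sum_{i=1}^{d-2}y_i-\sum_{i=1}^{d-2}x_i=z(d-1)$. -}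

module Defs where

open import Data.Bool using (Bool; true; false; _∧_)
open import Data.Nat as ℕ using (ℕ; zero; suc; _∸_; _≤_; _≤ᵇ_; _≡ᵇ_; _⊓_)
open import Data.Integer as ℤ using (ℤ; +_; _-_)
open import Data.List using (List; []; _∷_; _++_; map; upTo; length; filterᵇ; foldr)
open import Data.List.Relation.Unary.All using (All)
open import Data.List.Relation.Unary.Linked using (Linked)
open import Data.List.Membership.Propositional using (_∈_)
open import Data.Vec as Vec using (Vec; tabulate; toList)
open import Data.Fin using (Fin; toℕ)
open import Data.Product using (Σ; _×_; _,_; proj₁; proj₂)
open import Data.Sum using (_⊎_)
open import Relation.Binary.PropositionalEquality using (_≡_; _≢_)
open import Relation.Nullary using (¬_)
open import Function.Bundles using (_⇔_)

Cell : Set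
Cell = ℕ × ℕ   -- (row , column), 1-based

-- A Ferrers diagram is encoded by its list of row lengths (row 1 first).
-- The encoding is canonical: positive, weakly decreasing lengths.
Diagram : Set
Diagram = List ℕ

IsFerrers : Diagram → Set
IsFerrers D = All (λ l → 1 ≤ l) D × Linked ℕ._≥_ D

cellsFrom : ℕ → Diagram → List Cell
cellsFrom x []       = []
cellsFrom x (l ∷ ls) = map (λ y → (x , suc y)) (upTo l) ++ cellsFrom (suc x) ls

cells : Diagram → List Cell
cells = cellsFrom 1

-- cardinality of a (duplicate-free) list filtered by a boolean predicate
count : {A : Set} → (A → Bool) → List A → ℕ
count p xs = length (filterᵇ p xs)

ν : ℕ → ℕ → Diagram → ℕ
ν d j D = count (λ c → ((d ∸ j) ≤ᵇ proj₁ c) ∧ (suc j ≤ᵇ proj₂ c)) (cells D)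

νmin : ℕ → Diagram → ℕ
νmin d D = foldr _⊓_ (ν d 0 D) (map (λ j → ν d j D) (upTo d))

IsRemoval : Diagram → Cell → Diagram → Set
IsRemoval D P D' = (q : Cell) → (q ∈ cells D') ⇔ (q ∈ cells D × q ≢ P)

-- Arrow d D₁ D₂  means  D₁ --d--> D₂
Arrow : ℕ → Diagram → Diagram → Set
Arrow d D₁ D₂ =
    Σ Cell (λ P → P ∈ cells D₂ × IsRemoval D₂ P D₁ × νmin d D₁ ≡ νmin d D₂)
  ⊎ Σ Cell (λ P → P ∈ cells D₁ × IsRemoval D₁ P D₂ × νmin d D₂ ≢ νmin d D₁)

Irreducible : ℕ → Diagram → Set
Irreducible d D = (D' : Diagram) → IsFerrers D' → ¬ Arrow d D' D

StandardForm : ℕ → Diagram → ℕ → ℕ → Set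
StandardForm d D a b =
  (d ∸ 1 ≤ a) × (d ∸ 1 ≤ b) ×
  ((x y : ℕ) → d ∸ 1 ≤ x → d ∸ 1 ≤ y → ((x , y) ∈ cells D) ⇔ ((x ≤ a) × (y ≤ b)))

-- membership in 𝔦𝔯𝔯_d^μ, witnessed by the standard-form parameters (a,b)
InIrr : ℕ → ℕ → Diagram → ℕ → ℕ → Set
InIrr d μ D a b = IsFerrers D × Irreducible d D × StandardForm d D a b × (a ⊓ b ≡ μ)

swap : Cell → Cell
swap (x , y) = (y , x)

Xset : ℕ → Diagram → ℕ → List Cell
Xset d D b = map swap (filterᵇ (λ c → (1 ≤ᵇ proj₁ c) ∧ (proj₁ c ≤ᵇ (d ∸ 2)) ∧ (suc b ≤ᵇ proj₂ c)) (cells D))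

Yset : ℕ → Diagram → ℕ → List Cell
Yset d D a = filterᵇ (λ c → (suc a ≤ᵇ proj₁ c) ∧ (1 ≤ᵇ proj₂ c) ∧ (proj₂ c ≤ᵇ (d ∸ 2))) (cells D)

cnt : ℕ → List Cell → ℕ
cnt i Z = count (λ c → proj₂ c ≡ᵇ i) Z

-- points of ℤ^{2d-3}: (x_1..x_{d-2}, y_1..y_{d-2}, z)
Point : ℕ → Set
Point d = Vec ℤ (d ∸ 2) × Vec ℤ (d ∸ 2) × ℤ

Ψ : (d : ℕ) → Diagram → ℕ → ℕ → Point d
Ψ d D a b =
  ( tabulate (λ (k : Fin (d ∸ 2)) → + cnt (suc (toℕ k)) (Xset d D b))
  , tabulate (λ (k : Fin (d ∸ 2)) → + cnt (suc (toℕ k)) (Yset d D a))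
  , (+ b) - (+ a) )

-- 1-based access, 0 outside range (only used inside the range)
at : {n : ℕ} → Vec ℤ n → ℕ → ℤ
at Vec.[]       _             = + 0
at (v Vec.∷ vs) zero          = + 0
at (v Vec.∷ vs) (suc zero)    = v
at (v Vec.∷ vs) (suc (suc i)) = at vs (suc i)

sumℤ : List ℤ → ℤ
sumℤ = foldr ℤ._+_ (+ 0)

InP : (d : ℕ) → Point d → Set
InP d (x , y , z) =
  ((j : ℕ) → 1 ≤ j → j ≤ d ∸ 3 → (at x (suc j) ℤ.≤ at x j) × (at y (suc j) ℤ.≤ at y j)) ×
  ((j : ℕ) → 1 ≤ j → j ≤ d ∸ 2 → (+ 0 ℤ.≤ at x j) × (+ 0 ℤ.≤ at y j)) ×
  ((j : ℕ) → 1 ≤ j → j ≤ d ∸ 2 →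
     + 0 ℤ.≤ ((+ j) ℤ.* ((z ℤ.+ (+ (d ∸ 1))) - (+ j))
              ℤ.+ sumℤ (map (λ i → at x ((d ∸ 2) ∸ i)) (upTo (j ∸ 1))))
              - sumℤ (map (λ i → at y (suc i)) (upTo j))) ×
  (sumℤ (toList y) - sumℤ (toList x) ≡ z ℤ.* (+ (d ∸ 1)))

-- Write d = e + 2 and let D be in (a,b)-standard form with a, b ≥ μ ≥ d. Its row lengths split
-- into an arm (rows 1..e, of lengths b + x_i with x_i = c_i(X)), a body (rows e+1..a, of length b)
-- and a leg (the rows below a, of length at most e, whose column counts are y_i = c_i(Y)). The leg
-- is thus the partition conjugate to y, so D is determined by (a, b, x, y), and (a, b) by z = b − a
-- because a ⊓ b = μ. Conversely any antitone x, y ≥ 0 and any z give a diagram of this shape.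
--
-- Summing ν_j = Σ_{x ≥ d−j} (f x ∸ j) over arm, body and leg shows that the j-th inequality of 𝔓_d
-- says ν_0 ≤ ν_j and that its equation says ν_0 = ν_{d−1}. This is exactly irreducibility. If ν_0
-- and ν_{d−1} are minimal, every corner lies in one of their quadrants and every addable cell
-- misses one of them, so no arrow ends at D. If D is irreducible, every addable cell misses some
-- minimal quadrant and every corner meets one; were the least (or greatest) minimiser an inner
-- index k + 1, this would force rows e − k and e − k + 1 to have equal length and no later row to
-- have length k + 1, whence ν_k + ν_{k+2} + 2 = 2 ν_{k+1}, impossible at a minimum.

module Submission where

open import Defs
open import Data.Bool using (Bool; true; false; _∧_; T)
open import Data.Bool.Properties using (∧-zeroʳ; ∧-identityʳ)
open import Data.Empty using (⊥; ⊥-elim)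
open import Data.Fin using (toℕ)
open import Data.Integer as ℤ using (ℤ; +_; -[1+_]; _-_)
import Data.Integer.Properties as ℤ
open import Data.Integer.Tactic.RingSolver using () renaming (solve-∀ to ℤ-solve-∀)
open import Data.List using (List; []; _∷_; _++_; map; upTo; applyUpTo; length; filterᵇ; foldr)
open import Data.List.Membership.Propositional using (_∈_)
open import Data.List.Membership.Propositional.Properties using (∈-map⁺; ∈-map⁻; ∈-++⁺ˡ; ∈-++⁺ʳ; ∈-++⁻; ∈-upTo⁺; ∈-upTo⁻)
open import Data.List.Properties using (map-upTo)
open import Data.List.Relation.Unary.All using ([]; _∷_)
open import Data.List.Relation.Unary.Any using (here; there)
open import Data.List.Relation.Unary.Linked as Linked using ([]; [-]; _∷_)
open import Data.Nat using (ℕ; zero; suc; pred; >-nonZero; _+_; _*_; _∸_; _⊓_; _≤_; _<_; _≤′_; _≤ᵇ_; _≡ᵇ_; _≟_; _≤?_; _<?_)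
open import Data.Nat using (z≤n; s≤s; s≤s⁻¹; z<s; s<s; ≤′-refl; ≤′-step)
open import Data.Nat.Properties
open import Data.Nat.Tactic.RingSolver using (solve-∀)
open import Algebra.Properties.CommutativeSemigroup +-commutativeSemigroup using (interchange; xy∙z≈xz∙y)
open import Data.Product using (Σ; ∃; _×_; _,_; _,′_; proj₁; proj₂)
open import Data.Sum as Sum using (_⊎_; inj₁; inj₂)
open import Data.Vec using (Vec; []; _∷_; tabulate; toList)
open import Function using (_∘_)
open import Function.Bundles using (_⇔_; mk⇔; Equivalence)
open import Relation.Binary.PropositionalEquality
open import Relation.Nullary using (¬_; Dec; yes; no; contradiction)
open import Relation.Nullary.Decidable using (dec-true; dec-false; does-⇔)
open import Relation.Unary using (Decidable)


∑< : ℕ → (ℕ → ℕ) → ℕ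
∑< zero    f = 0
∑< (suc n) f = f 0 + ∑< n (f ∘ suc)

syntax ∑< n (λ i → e) = ∑[ i < n ] e

∑<-cong : ∀ n {f g : ℕ → ℕ} → (∀ i → i < n → f i ≡ g i) → ∑< n f ≡ ∑< n g
∑<-cong zero    f≡g = refl
∑<-cong (suc n) f≡g = cong₂ _+_ (f≡g 0 z<s) (∑<-cong n (λ i i<n → f≡g (suc i) (s<s i<n)))

∑<-mono-≤ : ∀ n {f g : ℕ → ℕ} → (∀ i → i < n → f i ≤ g i) → ∑< n f ≤ ∑< n g
∑<-mono-≤ zero    f≤g = z≤n
∑<-mono-≤ (suc n) f≤g = +-mono-≤ (f≤g 0 z<s) (∑<-mono-≤ n (λ i i<n → f≤g (suc i) (s<s i<n)))

∑<-zero : ∀ n {f : ℕ → ℕ} → (∀ i → i < n → f i ≡ 0) → ∑< n f ≡ 0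
∑<-zero zero    f≡0 = refl
∑<-zero (suc n) f≡0 = cong₂ _+_ (f≡0 0 z<s) (∑<-zero n (λ i i<n → f≡0 (suc i) (s<s i<n)))

∑<-distrib-+ : ∀ n (f g : ℕ → ℕ) → ∑[ i < n ] (f i + g i) ≡ ∑< n f + ∑< n g
∑<-distrib-+ zero    f g = refl
∑<-distrib-+ (suc n) f g =
  trans (cong (_+_ (f 0 + g 0)) (∑<-distrib-+ n (f ∘ suc) (g ∘ suc))) (interchange (f 0) (g 0) _ _)

∑<-*ˡ : ∀ n c (f : ℕ → ℕ) → ∑[ i < n ] (c * f i) ≡ c * ∑< n f
∑<-*ˡ zero    c f = sym (*-zeroʳ c)
∑<-*ˡ (suc n) c f = trans (cong (_+_ (c * f 0)) (∑<-*ˡ n c (f ∘ suc))) (sym (*-distribˡ-+ c (f 0) _))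

∑<-*ʳ : ∀ n c (f : ℕ → ℕ) → ∑[ i < n ] (f i * c) ≡ ∑< n f * c
∑<-*ʳ n c f = trans (∑<-cong n (λ i _ → *-comm (f i) c)) (trans (∑<-*ˡ n c f) (*-comm c _))

∑<-+ : ∀ m n (f : ℕ → ℕ) → ∑< (m + n) f ≡ ∑< m f + ∑[ i < n ] f (m + i)
∑<-+ zero    n f = refl
∑<-+ (suc m) n f = trans (cong (_+_ (f 0)) (∑<-+ m n (f ∘ suc))) (sym (+-assoc (f 0) _ _))

∑<-suc : ∀ n (f : ℕ → ℕ) → ∑< (suc n) f ≡ ∑< n f + f n
∑<-suc zero    f = +-comm (f 0) 0
∑<-suc (suc n) f = trans (cong (_+_ (f 0)) (∑<-suc n (f ∘ suc))) (sym (+-assoc (f 0) _ _))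

∑<-single : ∀ n k (f : ℕ → ℕ) → k < n → (∀ i → i < n → i ≢ k → f i ≡ 0) → ∑< n f ≡ f k
∑<-single (suc n) zero    f _         f≡0 = trans (cong (_+_ (f 0)) (∑<-zero n (λ i i<n → f≡0 (suc i) (s<s i<n) λ ()))) (+-identityʳ _)
∑<-single (suc n) (suc k) f (s<s k<n) f≡0 =
  trans (cong (_+ ∑< n (f ∘ suc)) (f≡0 0 z<s λ ()))
        (∑<-single n k (f ∘ suc) k<n (λ i i<n i≢k → f≡0 (suc i) (s<s i<n) (i≢k ∘ suc-injective)))

∑<-truncate : ∀ n N {f : ℕ → ℕ} → n ≤ N → (∀ i → n ≤ i → i < N → f i ≡ 0) → ∑< N f ≡ ∑< n f
∑<-truncate n N {f} n≤N f≡0 = begin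
  ∑< N f                                ≡⟨ cong (λ m → ∑< m f) (m+[n∸m]≡n n≤N) ⟨
  ∑< (n + (N ∸ n)) f                    ≡⟨ ∑<-+ n (N ∸ n) f ⟩
  ∑< n f + ∑[ i < N ∸ n ] f (n + i)     ≡⟨ cong (_+_ (∑< n f)) (∑<-zero (N ∸ n) tail≡0) ⟩
  ∑< n f + 0                            ≡⟨ +-identityʳ _ ⟩
  ∑< n f                                ∎
  where
  open ≡-Reasoning
  tail≡0 : ∀ i → i < N ∸ n → f (n + i) ≡ 0
  tail≡0 i i<N∸n = f≡0 (n + i) (m≤m+n n i) (subst (n + i <_) (m+[n∸m]≡n n≤N) (+-monoʳ-< n i<N∸n))

∑<-comm : ∀ n m (f : ℕ → ℕ → ℕ) → ∑[ i < n ] ∑[ j < m ] f i j ≡ ∑[ j < m ] ∑[ i < n ] f i j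
∑<-comm zero    m f = sym (∑<-zero m (λ _ _ → refl))
∑<-comm (suc n) m f = trans (cong (_+_ (∑< m (f 0))) (∑<-comm n m (f ∘ suc)))
                            (sym (∑<-distrib-+ m (f 0) (λ j → ∑[ i < n ] f (suc i) j)))

∑<-reverse : ∀ n (f : ℕ → ℕ) → ∑[ i < n ] f (n ∸ suc i) ≡ ∑< n f
∑<-reverse zero    f = refl
∑<-reverse (suc n) f = trans (+-comm (f n) _) (trans (cong (_+ f n) (∑<-reverse n f)) (sym (∑<-suc n f)))

∑<-update : ∀ n k {f f′ : ℕ → ℕ} δ → k < n → f′ k ≡ f k + δ → (∀ i → i < n → i ≢ k → f′ i ≡ f i) →
            ∑< n f′ ≡ ∑< n f + δ
∑<-update (suc n) zero {f} {f′} δ _ f′0 f′≡f = begin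
  f′ 0 + ∑[ i < n ] f′ (suc i)       ≡⟨ cong₂ _+_ f′0 (∑<-cong n (λ i i<n → f′≡f (suc i) (s<s i<n) λ ())) ⟩
  f 0 + δ + ∑[ i < n ] f (suc i)     ≡⟨ xy∙z≈xz∙y (f 0) δ _ ⟩
  f 0 + ∑[ i < n ] f (suc i) + δ     ∎
  where open ≡-Reasoning
∑<-update (suc n) (suc k) {f} {f′} δ (s<s k<n) f′k f′≡f = begin
  f′ 0 + ∑[ i < n ] f′ (suc i)           ≡⟨ cong₂ _+_ (f′≡f 0 z<s λ ()) (∑<-update n k δ k<n f′k rest) ⟩
  f 0 + (∑[ i < n ] f (suc i) + δ)       ≡⟨ +-assoc (f 0) _ δ ⟨
  f 0 + ∑[ i < n ] f (suc i) + δ         ∎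
  where
  open ≡-Reasoning
  rest : ∀ i → i < n → i ≢ k → f′ (suc i) ≡ f (suc i)
  rest i i<n i≢k = f′≡f (suc i) (s<s i<n) (i≢k ∘ suc-injective)

𝟙 : Bool → ℕ
𝟙 true  = 1
𝟙 false = 0

𝟙≤1 : ∀ b → 𝟙 b ≤ 1
𝟙≤1 true  = ≤-refl
𝟙≤1 false = z≤n

∑<-𝟙-≤ : ∀ n (p : ℕ → Bool) → ∑[ i < n ] 𝟙 (p i) ≤ n
∑<-𝟙-≤ n p = ≤-trans (∑<-mono-≤ n (λ i _ → 𝟙≤1 (p i))) (≤-reflexive (∑<-const-1 n))
  where
  ∑<-const-1 : ∀ n → ∑[ i < n ] 1 ≡ n
  ∑<-const-1 zero    = refl
  ∑<-const-1 (suc n) = cong suc (∑<-const-1 n)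

≤ᵇ-true : ∀ {m n} → m ≤ n → (m ≤ᵇ n) ≡ true
≤ᵇ-true {m} {n} = dec-true (m ≤? n)

≤ᵇ-false : ∀ {m n} → n < m → (m ≤ᵇ n) ≡ false
≤ᵇ-false {m} {n} n<m = dec-false (m ≤? n) (<⇒≱ n<m)

≤ᵇ-true⁻¹ : ∀ {m n} → (m ≤ᵇ n) ≡ true → m ≤ n
≤ᵇ-true⁻¹ {m} {n} m≤ᵇn = ≤ᵇ⇒≤ m n (subst T (sym m≤ᵇn) _)

≤ᵇ-cong : ∀ {m n m′ n′} → (m ≤ n ⇔ m′ ≤ n′) → (m ≤ᵇ n) ≡ (m′ ≤ᵇ n′)
≤ᵇ-cong {m} {n} {m′} {n′} m≤n⇔m′≤n′ = does-⇔ m≤n⇔m′≤n′ (m ≤? n) (m′ ≤? n′)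

suc≤ᵇsuc : ∀ m n → (suc m ≤ᵇ suc n) ≡ (m ≤ᵇ n)
suc≤ᵇsuc m n = ≤ᵇ-cong {suc m} {suc n} {m} {n} (mk⇔ s≤s⁻¹ s≤s)

≡ᵇ-true : ∀ m → (m ≡ᵇ m) ≡ true
≡ᵇ-true m = dec-true (m ≟ m) refl

≡ᵇ-false : ∀ {m n} → m ≢ n → (m ≡ᵇ n) ≡ false
≡ᵇ-false {m} {n} = dec-false (m ≟ n)

𝟙-≤ᵇ-1 : ∀ {m n} → m ≤ n → 𝟙 (m ≤ᵇ n) ≡ 1
𝟙-≤ᵇ-1 = cong 𝟙 ∘ ≤ᵇ-true

𝟙-≤ᵇ-0 : ∀ {m n} → n < m → 𝟙 (m ≤ᵇ n) ≡ 0
𝟙-≤ᵇ-0 = cong 𝟙 ∘ ≤ᵇ-false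

𝟙-suc-≤ᵇ : ∀ m n → 𝟙 (suc m ≤ᵇ n) ≤ 𝟙 (m ≤ᵇ n)
𝟙-suc-≤ᵇ m n with suc m ≤? n
... | yes m<n = ≤-reflexive (trans (𝟙-≤ᵇ-1 m<n) (sym (𝟙-≤ᵇ-1 (<⇒≤ m<n))))
... | no  m≮n = subst (_≤ 𝟙 (m ≤ᵇ n)) (sym (𝟙-≤ᵇ-0 (≰⇒> m≮n))) z≤n

∑<-count-≥ : ∀ n k → ∑[ i < n ] 𝟙 (k ≤ᵇ i) ≡ n ∸ k
∑<-count-≥ zero    k = sym (0∸n≡0 k)
∑<-count-≥ (suc n) k with k ≤? n
... | yes k≤n = begin
  ∑[ i < suc n ] 𝟙 (k ≤ᵇ i)          ≡⟨ ∑<-suc n _ ⟩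
  ∑[ i < n ] 𝟙 (k ≤ᵇ i) + 𝟙 (k ≤ᵇ n)  ≡⟨ cong₂ _+_ (∑<-count-≥ n k) (𝟙-≤ᵇ-1 k≤n) ⟩
  n ∸ k + 1                          ≡⟨ +-comm (n ∸ k) 1 ⟩
  suc (n ∸ k)                        ≡⟨ +-∸-assoc 1 k≤n ⟨
  suc n ∸ k                          ∎
  where open ≡-Reasoning
... | no k≰n = begin
  ∑[ i < suc n ] 𝟙 (k ≤ᵇ i)          ≡⟨ ∑<-suc n _ ⟩
  ∑[ i < n ] 𝟙 (k ≤ᵇ i) + 𝟙 (k ≤ᵇ n)  ≡⟨ cong₂ _+_ (∑<-count-≥ n k) (𝟙-≤ᵇ-0 (≰⇒> k≰n)) ⟩
  n ∸ k + 0                          ≡⟨ +-identityʳ _ ⟩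
  n ∸ k                              ≡⟨ m≤n⇒m∸n≡0 (<⇒≤ (≰⇒> k≰n)) ⟩
  0                                  ≡⟨ m≤n⇒m∸n≡0 (≰⇒> k≰n) ⟨
  suc n ∸ k                          ∎
  where open ≡-Reasoning

∑<-count-< : ∀ n c → c ≤ n → ∑[ i < n ] 𝟙 (suc i ≤ᵇ c) ≡ c
∑<-count-< n       zero    _         = ∑<-zero n (λ _ _ → refl)
∑<-count-< (suc n) (suc c) (s≤s c≤n) = cong suc (trans (∑<-cong n (λ i _ → cong 𝟙 (suc≤ᵇsuc (suc i) c))) (∑<-count-< n c c≤n))

∑<-prefix : ∀ n c (f : ℕ → ℕ) → c ≤ n → ∑[ i < n ] (𝟙 (suc i ≤ᵇ c) * f i) ≡ ∑< c f
∑<-prefix n c f c≤n = begin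
  ∑[ i < n ] (𝟙 (suc i ≤ᵇ c) * f i)  ≡⟨ ∑<-truncate c n c≤n (λ i c≤i _ → cong (_* f i) (𝟙-≤ᵇ-0 (s≤s c≤i))) ⟩
  ∑[ i < c ] (𝟙 (suc i ≤ᵇ c) * f i)  ≡⟨ ∑<-cong c (λ i i<c → trans (cong (_* f i) (𝟙-≤ᵇ-1 i<c)) (+-identityʳ (f i))) ⟩
  ∑< c f                             ∎
  where open ≡-Reasoning

∸-as-∑ : ∀ m c j → c ≤ m → c ∸ j ≡ ∑[ i < m ] (𝟙 (j ≤ᵇ i) * 𝟙 (suc i ≤ᵇ c))
∸-as-∑ m c j c≤m = begin
  c ∸ j                                     ≡⟨ ∑<-count-≥ c j ⟨
  ∑[ i < c ] 𝟙 (j ≤ᵇ i)                     ≡⟨ ∑<-prefix m c (λ i → 𝟙 (j ≤ᵇ i)) c≤m ⟨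
  ∑[ i < m ] (𝟙 (suc i ≤ᵇ c) * 𝟙 (j ≤ᵇ i))  ≡⟨ ∑<-cong m (λ i _ → *-comm (𝟙 (suc i ≤ᵇ c)) _) ⟩
  ∑[ i < m ] (𝟙 (j ≤ᵇ i) * 𝟙 (suc i ≤ᵇ c))  ∎
  where open ≡-Reasoning

DownClosed : ℕ → (ℕ → Bool) → Set
DownClosed n h = ∀ k → suc k < n → h (suc k) ≡ true → h k ≡ true

downClosed-false : ∀ n h → DownClosed n h → h 0 ≡ false → ∀ k → k < n → h k ≡ false
downClosed-false n h closed h0 zero    _   = h0
downClosed-false n h closed h0 (suc k) k<n with h (suc k) in hk
... | false = refl
... | true  = trans (sym (closed k k<n hk)) (downClosed-false n h closed h0 k (<-trans (n<1+n k) k<n))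

count-downClosed : ∀ n h → DownClosed n h → ∀ k → k < n → (suc k ≤ᵇ ∑[ i < n ] 𝟙 (h i)) ≡ h k
count-downClosed (suc n) h closed k k<n with h 0 in h0
count-downClosed (suc n) h closed zero    _         | true = sym h0
count-downClosed (suc n) h closed (suc k) (s<s k<n) | true =
  trans (suc≤ᵇsuc (suc k) (∑[ i < n ] 𝟙 (h (suc i)))) (count-downClosed n (h ∘ suc) (λ k k<n → closed (suc k) (s<s k<n)) k k<n)
count-downClosed (suc n) h closed k       k<n       | false = begin
  (suc k ≤ᵇ ∑[ i < n ] 𝟙 (h (suc i)))  ≡⟨ cong (suc k ≤ᵇ_) (∑<-zero n (λ i i<n → cong 𝟙 (h-false (suc i) (s<s i<n)))) ⟩
  false                                ≡⟨ h-false k k<n ⟨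
  h k                                  ∎
  where
  open ≡-Reasoning
  h-false : ∀ k → k < suc n → h k ≡ false
  h-false = downClosed-false (suc n) h closed h0

module _ {P : ℕ → Set} (P? : Decidable P) where

  least-below : ∀ n → (∃ λ m → m < n × P m) → ∃ λ k → k < n × P k × (∀ j → j < k → ¬ P j)
  least-below (suc n) (m , m<1+n , pm) with anyUpTo? P? n
  ... | yes below = let k , k<n , pk , least = least-below n below in k , <-trans k<n (n<1+n n) , pk , least
  ... | no  none  = n , n<1+n n , subst P m≡n pm , λ j j<n pj → none (j , j<n , pj)
    where
    m≡n : m ≡ n
    m≡n with m ≟ n
    ... | yes m≡n = m≡n
    ... | no  m≢n = contradiction (m , ≤∧≢⇒< (s≤s⁻¹ m<1+n) m≢n , pm) none

  greatest-below : ∀ n → (∃ λ m → m < n × P m) → ∃ λ k → k < n × P k × (∀ j → k < j → j < n → ¬ P j)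
  greatest-below (suc n) (m , m<1+n , pm) with P? n
  ... | yes pn  = n , n<1+n n , pn , λ j n<j j<1+n → contradiction (s≤s⁻¹ j<1+n) (<⇒≱ n<j)
  ... | no  ¬pn with greatest-below n (m , ≤∧≢⇒< (s≤s⁻¹ m<1+n) (λ m≡n → ¬pn (subst P m≡n pm)) , pm)
  ...   | k , k<n , pk , greatest = k , <-trans k<n (n<1+n n) , pk , greatest′
    where
    greatest′ : ∀ j → k < j → j < suc n → ¬ P j
    greatest′ j k<j j<1+n with j ≟ n
    ... | yes refl = ¬pn
    ... | no  j≢n  = greatest j k<j (≤∧≢⇒< (s≤s⁻¹ j<1+n) j≢n)


sumℤ-applyUpTo : ∀ n (g : ℕ → ℤ) (u : ℕ → ℕ) → (∀ i → i < n → g i ≡ + u i) → sumℤ (applyUpTo g n) ≡ + ∑< n u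
sumℤ-applyUpTo zero    g u g≡u = refl
sumℤ-applyUpTo (suc n) g u g≡u =
  trans (cong₂ ℤ._+_ (g≡u 0 z<s) (sumℤ-applyUpTo n (g ∘ suc) (u ∘ suc) (λ i i<n → g≡u (suc i) (s<s i<n))))
        (sym (ℤ.pos-+ (u 0) _))

sumℤ-map-upTo : ∀ n (g : ℕ → ℤ) (u : ℕ → ℕ) → (∀ i → i < n → g i ≡ + u i) → sumℤ (map g (upTo n)) ≡ + ∑< n u
sumℤ-map-upTo n g u g≡u = trans (cong sumℤ (map-upTo g n)) (sumℤ-applyUpTo n g u g≡u)

sumℤ-toList : ∀ {n} (v : Vec ℤ n) (u : ℕ → ℕ) → (∀ i → i < n → at v (suc i) ≡ + u i) → sumℤ (toList v) ≡ + ∑< n u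
sumℤ-toList []       u v≡u = refl
sumℤ-toList (x ∷ xs) u v≡u =
  trans (cong₂ ℤ._+_ (v≡u 0 z<s) (sumℤ-toList xs (u ∘ suc) (λ i i<n → v≡u (suc i) (s<s i<n))))
        (sym (ℤ.pos-+ (u 0) _))

at-tabulate : ∀ n (h : ℕ → ℤ) i → i < n → at (tabulate {n = n} (h ∘ toℕ)) (suc i) ≡ h i
at-tabulate (suc n) h zero    _         = refl
at-tabulate (suc n) h (suc i) (s<s i<n) = at-tabulate n (h ∘ suc) i i<n

tabulate-at : ∀ {n} (h : ℕ → ℤ) (v : Vec ℤ n) → (∀ i → i < n → h i ≡ at v (suc i)) → tabulate (h ∘ toℕ) ≡ v
tabulate-at h []       _      = refl
tabulate-at h (x ∷ xs) h≡v = cong₂ _∷_ (h≡v 0 z<s) (tabulate-at (h ∘ suc) xs (λ i i<n → h≡v (suc i) (s<s i<n)))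

+-split : ∀ m k {n} → n ≡ m + k → + n ≡ + m ℤ.+ + k
+-split m k refl = ℤ.pos-+ m k

+-cast : ∀ k m n → + (k + m * n) ≡ + k ℤ.+ + m ℤ.* + n
+-cast k m n = trans (ℤ.pos-+ k (m * n)) (cong (ℤ._+_ (+ k)) (ℤ.pos-* m n))

ℤ-diff⇔ℕ : ∀ {p q u v} → (+ p - + q ≡ + u - + v) ⇔ (p + v ≡ u + q)
ℤ-diff⇔ℕ {p} {q} {u} {v} = mk⇔ to from
  where
  open ≡-Reasoning
  shift : ∀ x y w → x ℤ.+ w ≡ (x - y) ℤ.+ (y ℤ.+ w)
  shift = ℤ-solve-∀
  unshift : ∀ x y w → (x - w) ℤ.+ (y ℤ.+ w) ≡ x ℤ.+ y
  unshift = ℤ-solve-∀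
  to : + p - + q ≡ + u - + v → p + v ≡ u + q
  to p-q≡u-v = ℤ.+-injective (begin
    + p ℤ.+ + v                       ≡⟨ shift (+ p) (+ q) (+ v) ⟩
    (+ p - + q) ℤ.+ (+ q ℤ.+ + v)     ≡⟨ cong (ℤ._+ (+ q ℤ.+ + v)) p-q≡u-v ⟩
    (+ u - + v) ℤ.+ (+ q ℤ.+ + v)     ≡⟨ unshift (+ u) (+ q) (+ v) ⟩
    + u ℤ.+ + q                       ∎)
  from : p + v ≡ u + q → + p - + q ≡ + u - + v
  from p+v≡u+q = begin
    + p - + q                         ≡⟨ widen (+ p) (+ q) (+ v) ⟩
    (+ p ℤ.+ + v) - (+ q ℤ.+ + v)     ≡⟨ cong (_- (+ q ℤ.+ + v)) (trans (sym (ℤ.pos-+ p v)) (+-split u q p+v≡u+q)) ⟩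
    (+ u ℤ.+ + q) - (+ q ℤ.+ + v)     ≡⟨ narrow (+ u) (+ q) (+ v) ⟩
    + u - + v                         ∎
    where
    widen : ∀ x y w → x - y ≡ (x ℤ.+ w) - (y ℤ.+ w)
    widen = ℤ-solve-∀
    narrow : ∀ x y w → (x ℤ.+ y) - (y ℤ.+ w) ≡ x - w
    narrow = ℤ-solve-∀

sum-of-≥ : ∀ {μ x y} → μ ≤ x → μ ≤ y → x + y ≡ μ + μ → x ≡ μ × y ≡ μ
sum-of-≥ {μ} {x} {y} μ≤x μ≤y x+y≡2μ =
  ≤-antisym (+-cancelʳ-≤ μ x μ (≤-trans (+-monoʳ-≤ x μ≤y) (≤-reflexive x+y≡2μ))) μ≤x ,
  ≤-antisym (+-cancelˡ-≤ μ y μ (≤-trans (+-monoˡ-≤ y μ≤x) (≤-reflexive x+y≡2μ))) μ≤y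

⊓≡⇒≤ : ∀ {a b μ} → a ⊓ b ≡ μ → μ ≤ a × μ ≤ b
⊓≡⇒≤ {a} {b} refl = m⊓n≤m a b , m⊓n≤n a b

minDiff-surjective : ∀ μ z → ∃ λ a → ∃ λ b → a ⊓ b ≡ μ × + b - + a ≡ z
minDiff-surjective μ (+ n)    = μ , μ + n , m≤n⇒m⊓n≡m (m≤m+n μ n) ,
                                trans (Equivalence.from (ℤ-diff⇔ℕ {μ + n} {μ} {n} {0}) (trans (+-identityʳ _) (+-comm μ n)))
                                      (ℤ.+-identityʳ (+ n))
minDiff-surjective μ -[1+ n ] = μ + suc n , μ , m≥n⇒m⊓n≡n (m≤m+n μ (suc n)) ,
                                Equivalence.from (ℤ-diff⇔ℕ {μ} {μ + suc n} {0} {suc n}) refl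

minDiff-injective : ∀ {μ a₁ b₁ a₂ b₂} → a₁ ⊓ b₁ ≡ μ → a₂ ⊓ b₂ ≡ μ → + b₁ - + a₁ ≡ + b₂ - + a₂ →
                    a₁ ≡ a₂ × b₁ ≡ b₂
minDiff-injective {μ} {a₁} {b₁} {a₂} {b₂} min₁ min₂ diff = cases (⊓-sel a₁ b₁) (⊓-sel a₂ b₂)
  where
  balance : b₁ + a₂ ≡ b₂ + a₁
  balance = Equivalence.to (ℤ-diff⇔ℕ {b₁} {a₁} {b₂} {a₂}) diff
  cases : a₁ ⊓ b₁ ≡ a₁ ⊎ a₁ ⊓ b₁ ≡ b₁ → a₂ ⊓ b₂ ≡ a₂ ⊎ a₂ ⊓ b₂ ≡ b₂ → a₁ ≡ a₂ × b₁ ≡ b₂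
  cases (inj₁ ⊓≡a₁) (inj₁ ⊓≡a₂) = a₁≡a₂ , +-cancelʳ-≡ a₁ b₁ b₂ (trans (cong (_+_ b₁) a₁≡a₂) balance)
    where
    a₁≡a₂ : a₁ ≡ a₂
    a₁≡a₂ = trans (trans (sym ⊓≡a₁) min₁) (trans (sym min₂) ⊓≡a₂)
  cases (inj₂ ⊓≡b₁) (inj₂ ⊓≡b₂) = sym (+-cancelˡ-≡ b₁ a₂ a₁ (trans balance (cong (_+ a₁) (sym b₁≡b₂)))) , b₁≡b₂
    where
    b₁≡b₂ : b₁ ≡ b₂
    b₁≡b₂ = trans (trans (sym ⊓≡b₁) min₁) (trans (sym min₂) ⊓≡b₂)
  cases (inj₁ ⊓≡a₁) (inj₂ ⊓≡b₂) = trans a₁≡μ (sym (proj₂ both)) , trans (proj₁ both) (sym b₂≡μ)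
    where
    a₁≡μ : a₁ ≡ μ
    a₁≡μ = trans (sym ⊓≡a₁) min₁
    b₂≡μ : b₂ ≡ μ
    b₂≡μ = trans (sym ⊓≡b₂) min₂
    both : b₁ ≡ μ × a₂ ≡ μ
    both = sum-of-≥ (proj₂ (⊓≡⇒≤ min₁)) (proj₁ (⊓≡⇒≤ min₂)) (trans balance (cong₂ _+_ b₂≡μ a₁≡μ))
  cases (inj₂ ⊓≡b₁) (inj₁ ⊓≡a₂) = trans (proj₂ both) (sym a₂≡μ) , trans b₁≡μ (sym (proj₁ both))
    where
    b₁≡μ : b₁ ≡ μ
    b₁≡μ = trans (sym ⊓≡b₁) min₁
    a₂≡μ : a₂ ≡ μ
    a₂≡μ = trans (sym ⊓≡a₂) min₂
    both : b₂ ≡ μ × a₁ ≡ μ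
    both = sum-of-≥ (proj₂ (⊓≡⇒≤ min₂)) (proj₁ (⊓≡⇒≤ min₁)) (trans (sym balance) (cong₂ _+_ b₁≡μ a₂≡μ))


nthRow : Diagram → ℕ → ℕ
nthRow []       _       = 0
nthRow (l ∷ ls) zero    = l
nthRow (l ∷ ls) (suc i) = nthRow ls i

row : Diagram → ℕ → ℕ
row D zero    = 0
row D (suc i) = nthRow D i

nthRow-beyond : ∀ D {i} → length D ≤ i → nthRow D i ≡ 0
nthRow-beyond []       _             = refl
nthRow-beyond (l ∷ ls) (s≤s len≤i) = nthRow-beyond ls len≤i

row-beyond : ∀ D {x} → length D < x → row D x ≡ 0
row-beyond D {suc i} (s≤s len≤i) = nthRow-beyond D len≤i

row-pos⇒≤length : ∀ D x → 1 ≤ row D x → x ≤ length D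
row-pos⇒≤length D x pos with x ≤? length D
... | yes x≤len = x≤len
... | no  x≰len = contradiction (row-beyond D (≰⇒> x≰len)) (≢-sym (<⇒≢ pos))

rowCells : ℕ → ℕ → List Cell
rowCells x l = map (λ k → (x ,′ suc k)) (upTo l)

∈-cellsFrom⁻ : ∀ s D {x y} → (x , y) ∈ cellsFrom s D → ∃ λ i → x ≡ s + i × 1 ≤ y × y ≤ nthRow D i
∈-cellsFrom⁻ s (l ∷ ls) p with ∈-++⁻ (rowCells s l) p
... | inj₁ p∈row with ∈-map⁻ (λ k → (s ,′ suc k)) p∈row
...   | k , k∈ , refl = 0 , sym (+-identityʳ s) , s≤s z≤n , ∈-upTo⁻ k∈
∈-cellsFrom⁻ s (l ∷ ls) p | inj₂ p∈rest with ∈-cellsFrom⁻ (suc s) ls p∈rest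
...   | i , refl , 1≤y , y≤ = suc i , sym (+-suc s i) , 1≤y , y≤

∈-cellsFrom⁺ : ∀ s D i y → 1 ≤ y → y ≤ nthRow D i → (s + i , y) ∈ cellsFrom s D
∈-cellsFrom⁺ s []       i    (suc y) _ ()
∈-cellsFrom⁺ s (l ∷ ls) zero (suc y) _ y<l =
  subst (λ x → (x ,′ suc y) ∈ cellsFrom s (l ∷ ls)) (sym (+-identityʳ s))
        (∈-++⁺ˡ (∈-map⁺ (λ k → (s ,′ suc k)) (∈-upTo⁺ y<l)))
∈-cellsFrom⁺ s (l ∷ ls) (suc i) y 1≤y y≤ =
  subst (λ x → (x ,′ y) ∈ cellsFrom s (l ∷ ls)) (sym (+-suc s i))
        (∈-++⁺ʳ (rowCells s l) (∈-cellsFrom⁺ (suc s) ls i y 1≤y y≤))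

∈-cells⁻ : ∀ D {x y} → (x , y) ∈ cells D → 1 ≤ x × 1 ≤ y × y ≤ row D x
∈-cells⁻ D p with ∈-cellsFrom⁻ 1 D p
... | i , refl , 1≤y , y≤ = s≤s z≤n , 1≤y , y≤

∈-cells⁺ : ∀ D {x y} → 1 ≤ x → 1 ≤ y → y ≤ row D x → (x , y) ∈ cells D
∈-cells⁺ D {suc i} {y} _ = ∈-cellsFrom⁺ 1 D i y

module _ {A : Set} (p : A → Bool) where

  count-∷ : ∀ x xs → count p (x ∷ xs) ≡ 𝟙 (p x) + count p xs
  count-∷ x xs with p x
  ... | true  = refl
  ... | false = refl

  count-++ : ∀ xs ys → count p (xs ++ ys) ≡ count p xs + count p ys
  count-++ []       ys = refl
  count-++ (x ∷ xs) ys = begin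
    count p (x ∷ xs ++ ys)                 ≡⟨ count-∷ x (xs ++ ys) ⟩
    𝟙 (p x) + count p (xs ++ ys)           ≡⟨ cong (_+_ (𝟙 (p x))) (count-++ xs ys) ⟩
    𝟙 (p x) + (count p xs + count p ys)    ≡⟨ +-assoc (𝟙 (p x)) _ _ ⟨
    𝟙 (p x) + count p xs + count p ys      ≡⟨ cong (_+ count p ys) (count-∷ x xs) ⟨
    count p (x ∷ xs) + count p ys          ∎
    where open ≡-Reasoning

  count-applyUpTo : ∀ (h : ℕ → A) n → count p (applyUpTo h n) ≡ ∑[ k < n ] 𝟙 (p (h k))
  count-applyUpTo h zero    = refl
  count-applyUpTo h (suc n) = trans (count-∷ (h 0) _) (cong (_+_ (𝟙 (p (h 0)))) (count-applyUpTo (h ∘ suc) n))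

count-map : ∀ {A B : Set} (p : B → Bool) (f : A → B) xs → count p (map f xs) ≡ count (p ∘ f) xs
count-map p f []       = refl
count-map p f (x ∷ xs) =
  trans (count-∷ p (f x) (map f xs)) (trans (cong (_+_ (𝟙 (p (f x)))) (count-map p f xs)) (sym (count-∷ (p ∘ f) x xs)))

count-filter : ∀ {A : Set} (p q : A → Bool) xs → count p (filterᵇ q xs) ≡ count (λ x → q x ∧ p x) xs
count-filter p q []       = refl
count-filter p q (x ∷ xs) = trans head-step (sym (count-∷ (λ x → q x ∧ p x) x xs))
  where
  head-step : count p (filterᵇ q (x ∷ xs)) ≡ 𝟙 (q x ∧ p x) + count (λ x → q x ∧ p x) xs
  head-step with q x
  ... | true  = trans (count-∷ p x (filterᵇ q xs)) (cong (_+_ (𝟙 (p x))) (count-filter p q xs))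
  ... | false = count-filter p q xs

countRow : (Cell → Bool) → ℕ → ℕ → ℕ
countRow p x l = ∑[ k < l ] 𝟙 (p (x , suc k))

count-cellsFrom : ∀ (p : Cell → Bool) s D n → length D ≤ n →
                  count p (cellsFrom s D) ≡ ∑[ i < n ] countRow p (s + i) (nthRow D i)
count-cellsFrom p s []       n       _         = sym (∑<-zero n (λ _ _ → refl))
count-cellsFrom p s (l ∷ ls) (suc n) (s≤s len≤n) = begin
  count p (rowCells s l ++ cellsFrom (suc s) ls)
    ≡⟨ count-++ p (rowCells s l) _ ⟩
  count p (rowCells s l) + count p (cellsFrom (suc s) ls)
    ≡⟨ cong₂ _+_ (trans (cong (count p) (map-upTo (λ k → (s ,′ suc k)) l)) (count-applyUpTo p (λ k → (s , suc k)) l))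
                 (count-cellsFrom p (suc s) ls n len≤n) ⟩
  countRow p s l + ∑[ i < n ] countRow p (suc s + i) (nthRow ls i)
    ≡⟨ cong₂ _+_ (cong (λ x → countRow p x l) (+-identityʳ s))
                 (∑<-cong n (λ i _ → cong (λ x → countRow p x (nthRow ls i)) (+-suc s i))) ⟨
  countRow p (s + 0) l + ∑[ i < n ] countRow p (s + suc i) (nthRow ls i)
    ∎
  where open ≡-Reasoning

inQuadrant : ℕ → ℕ → Cell → Bool
inQuadrant d j c = ((d ∸ j) ≤ᵇ proj₁ c) ∧ (suc j ≤ᵇ proj₂ c)

-- Σ (f x ∸ j) over the rows s < x ≤ N; row x sits at index i = x − 1.
νᶠ : ℕ → ℕ → (ℕ → ℕ) → ℕ → ℕ
νᶠ s j f N = ∑[ i < N ] (𝟙 (s ≤ᵇ i) * (f (suc i) ∸ j))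

≤ᵇ-suc : ∀ m i → (m ≤ᵇ suc i) ≡ (pred m ≤ᵇ i)
≤ᵇ-suc zero    i = refl
≤ᵇ-suc (suc m) i = suc≤ᵇsuc m i

ν≡νᶠ : ∀ d j D N → length D ≤ N → ν d j D ≡ νᶠ (d ∸ suc j) j (row D) N
ν≡νᶠ d j D N len≤N = trans (count-cellsFrom (inQuadrant d j) 1 D N len≤N) (∑<-cong N (λ i _ → quadrantRow i (nthRow D i)))
  where
  quadrantRow : ∀ i l → countRow (inQuadrant d j) (suc i) l ≡ 𝟙 (d ∸ suc j ≤ᵇ i) * (l ∸ j)
  quadrantRow i l rewrite sym (pred[m∸n]≡m∸[1+n] d j) | sym (≤ᵇ-suc (d ∸ j) i) with d ∸ j ≤ᵇ suc i
  ... | true  = trans (∑<-cong l (λ k _ → cong 𝟙 (suc≤ᵇsuc j k))) (trans (∑<-count-≥ l j) (sym (+-identityʳ _)))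
  ... | false = ∑<-zero l (λ _ _ → refl)

module _ (e : ℕ) where

  foldr-⊓-≤ : ∀ xs {x} → x ∈ xs → foldr _⊓_ e xs ≤ x
  foldr-⊓-≤ (y ∷ ys) (here refl) = m⊓n≤m y _
  foldr-⊓-≤ (y ∷ ys) (there x∈ys) = ≤-trans (m⊓n≤n y _) (foldr-⊓-≤ ys x∈ys)

  foldr-⊓-greatest : ∀ xs {k} → k ≤ e → (∀ {x} → x ∈ xs → k ≤ x) → k ≤ foldr _⊓_ e xs
  foldr-⊓-greatest []       k≤e _   = k≤e
  foldr-⊓-greatest (y ∷ ys) k≤e k≤xs = ⊓-glb (k≤xs (here refl)) (foldr-⊓-greatest ys k≤e (k≤xs ∘ there))

  foldr-⊓-sel : ∀ xs → foldr _⊓_ e xs ≡ e ⊎ foldr _⊓_ e xs ∈ xs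
  foldr-⊓-sel []       = inj₁ refl
  foldr-⊓-sel (y ∷ ys) with ⊓-sel y (foldr _⊓_ e ys) | foldr-⊓-sel ys
  ... | inj₁ ⊓≡y    | _           = inj₂ (here ⊓≡y)
  ... | inj₂ ⊓≡rest | inj₁ rest≡e = inj₁ (trans ⊓≡rest rest≡e)
  ... | inj₂ ⊓≡rest | inj₂ rest∈ys = inj₂ (there (subst (_∈ ys) (sym ⊓≡rest) rest∈ys))

module _ (d : ℕ) (D : Diagram) where

  νmin-≤ : ∀ j → j < d → νmin d D ≤ ν d j D
  νmin-≤ j j<d = foldr-⊓-≤ (ν d 0 D) _ (∈-map⁺ (λ j → ν d j D) (∈-upTo⁺ j<d))

  νmin-greatest : ∀ k → 1 ≤ d → (∀ j → j < d → k ≤ ν d j D) → k ≤ νmin d D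
  νmin-greatest k 1≤d k≤ν = foldr-⊓-greatest (ν d 0 D) _ (k≤ν 0 1≤d) k≤νs
    where
    k≤νs : ∀ {x} → x ∈ map (λ j → ν d j D) (upTo d) → k ≤ x
    k≤νs x∈ with ∈-map⁻ (λ j → ν d j D) x∈
    ... | j , j∈ , refl = k≤ν j (∈-upTo⁻ j∈)

  νmin-attained : 1 ≤ d → ∃ λ j → j < d × νmin d D ≡ ν d j D
  νmin-attained 1≤d with foldr-⊓-sel (ν d 0 D) (map (λ j → ν d j D) (upTo d))
  ... | inj₁ νmin≡ν₀ = 0 , 1≤d , νmin≡ν₀
  ... | inj₂ νmin∈   with ∈-map⁻ (λ j → ν d j D) νmin∈
  ...   | j , j∈ , νmin≡νj = j , ∈-upTo⁻ j∈ , νmin≡νj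

Antitone : (ℕ → ℕ) → Set
Antitone g = ∀ i → g (suc i) ≤ g i

fromRows : (ℕ → ℕ) → ℕ → Diagram
fromRows g zero    = []
fromRows g (suc n) with g 0
... | zero  = []
... | suc l = suc l ∷ fromRows (g ∘ suc) n

antitone-zero : ∀ g → Antitone g → g 0 ≡ 0 → ∀ i → g i ≡ 0
antitone-zero g anti g0≡0 zero    = g0≡0
antitone-zero g anti g0≡0 (suc i) = n≤0⇒n≡0 (subst (g (suc i) ≤_) (antitone-zero g anti g0≡0 i) (anti i))

nthRow-fromRows : ∀ n g → Antitone g → (∀ i → n ≤ i → g i ≡ 0) → ∀ i → nthRow (fromRows g n) i ≡ g i
nthRow-fromRows zero    g anti g≡0 i = sym (g≡0 i z≤n)
nthRow-fromRows (suc n) g anti g≡0 i with g 0 in g0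
... | zero = sym (antitone-zero g anti g0 i)
nthRow-fromRows (suc n) g anti g≡0 zero    | suc l = sym g0
nthRow-fromRows (suc n) g anti g≡0 (suc i) | suc l =
  nthRow-fromRows n (g ∘ suc) (anti ∘ suc) (λ i n≤i → g≡0 (suc i) (s≤s n≤i)) i

length-fromRows : ∀ n g → length (fromRows g n) ≤ n
length-fromRows zero    g = z≤n
length-fromRows (suc n) g with g 0
... | zero  = z≤n
... | suc l = s≤s (length-fromRows n (g ∘ suc))

fromRows-head : ∀ n g {l ls} → fromRows g n ≡ l ∷ ls → l ≡ g 0
fromRows-head (suc n) g eq with g 0
fromRows-head (suc n) g refl | suc l = refl

fromRows-ferrers : ∀ n g → Antitone g → IsFerrers (fromRows g n)
fromRows-ferrers zero    g anti = [] , []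
fromRows-ferrers (suc n) g anti with g 0 in g0
... | zero  = [] , []
... | suc l with fromRows (g ∘ suc) n in rest | fromRows-ferrers n (g ∘ suc) (anti ∘ suc)
...   | []     | _           = s≤s z≤n ∷ [] , [-]
...   | l′ ∷ _ | (pos , lnk) = s≤s z≤n ∷ pos , head≤ ∷ lnk
  where
  head≤ : l′ ≤ suc l
  head≤ = subst₂ _≤_ (sym (fromRows-head n (g ∘ suc) rest)) g0 (anti 0)

ferrers-antitone : ∀ D → IsFerrers D → Antitone (nthRow D)
ferrers-antitone []           _                  i       = z≤n
ferrers-antitone (l ∷ [])     _                  i       = z≤n
ferrers-antitone (l ∷ m ∷ ls) (_ , (m≤l ∷ _))    zero    = m≤l
ferrers-antitone (l ∷ m ∷ ls) (_ ∷ pos , _ ∷ lnk) (suc i) = ferrers-antitone (m ∷ ls) (pos , lnk) i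

ferrers-pos : ∀ D → IsFerrers D → ∀ i → i < length D → 1 ≤ nthRow D i
ferrers-pos (l ∷ ls) (1≤l ∷ _   , _)   zero    _         = 1≤l
ferrers-pos (l ∷ ls) (_   ∷ pos , lnk) (suc i) (s<s i<n) = ferrers-pos ls (pos , Linked.tail lnk) i i<n

row-pos : ∀ D → IsFerrers D → ∀ {x} → 1 ≤ x → x ≤ length D → 1 ≤ row D x
row-pos D fer {suc i} _ i<len = ferrers-pos D fer i i<len

ferrers-ext : ∀ D₁ D₂ → IsFerrers D₁ → IsFerrers D₂ → (∀ i → nthRow D₁ i ≡ nthRow D₂ i) → D₁ ≡ D₂
ferrers-ext []       []         _               _                 _  = refl
ferrers-ext []       (l ∷ _)    _               (1≤l ∷ _ , _)     eq = contradiction (eq 0) (<⇒≢ 1≤l)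
ferrers-ext (l ∷ _)  []         (1≤l ∷ _ , _)   _                 eq = contradiction (eq 0) (≢-sym (<⇒≢ 1≤l))
ferrers-ext (l ∷ ls) (l′ ∷ ls′) (_ ∷ pos , lnk) (_ ∷ pos′ , lnk′) eq =
  cong₂ _∷_ (eq 0) (ferrers-ext ls ls′ (pos , Linked.tail lnk) (pos′ , Linked.tail lnk′) (eq ∘ suc))

antitone⇒≤ : ∀ {g} → Antitone g → ∀ {i j} → i ≤ j → g j ≤ g i
antitone⇒≤ {g} anti {i} i≤j = go (≤⇒≤′ i≤j)
  where
  go : ∀ {j} → i ≤′ j → g j ≤ g i
  go ≤′-refl        = ≤-refl
  go (≤′-step i≤′j) = ≤-trans (anti _) (go i≤′j)

row-antitone : ∀ D → IsFerrers D → ∀ {x y} → 1 ≤ x → x ≤ y → row D y ≤ row D x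
row-antitone D fer {suc i} {suc j} _ (s≤s i≤j) = antitone⇒≤ (ferrers-antitone D fer) i≤j

≤-from-segments : ∀ {m n} → (∀ y → 1 ≤ y → y ≤ m → y ≤ n) → m ≤ n
≤-from-segments {zero}  _      = z≤n
≤-from-segments {suc m} m⊆n = m⊆n (suc m) (s≤s z≤n) ≤-refl

≡-from-segments : ∀ {m n} → (∀ y → 1 ≤ y → (y ≤ m ⇔ y ≤ n)) → m ≡ n
≡-from-segments m⇔n = ≤-antisym (≤-from-segments (λ y 1≤y → Equivalence.to (m⇔n y 1≤y)))
                                (≤-from-segments (λ y 1≤y → Equivalence.from (m⇔n y 1≤y)))

segment-minus-point : ∀ {m n c} → 1 ≤ c → c ≤ m → (∀ y → 1 ≤ y → (y ≤ n ⇔ (y ≤ m × y ≢ c))) → c ≡ m × m ≡ suc n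
segment-minus-point {m} {n} {c} 1≤c c≤m seg = c≡m , ≤-antisym m≤1+n (subst (suc n ≤_) c≡m n<c)
  where
  open Equivalence
  n<c : n < c
  n<c = ≰⇒> (λ c≤n → proj₂ (to (seg c 1≤c) c≤n) refl)
  c≡m : c ≡ m
  c≡m with c ≟ m
  ... | yes c≡m = c≡m
  ... | no  c≢m = contradiction (≤-trans c≤m (from (seg m (≤-trans 1≤c c≤m)) (≤-refl , c≢m ∘ sym))) (<⇒≱ n<c)
  m≤1+n : m ≤ suc n
  m≤1+n = go m refl
    where
    go : ∀ m′ → m′ ≡ m → m′ ≤ suc n
    go zero             _    = z≤n
    go (suc zero)       _    = s≤s z≤n
    go (suc (suc m′)) refl = s≤s (from (seg (suc m′) (s≤s z≤n)) (n≤1+n _ , λ m′≡c → 1+n≢n (sym (trans m′≡c c≡m))))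


record LastCellRemoved (D : Diagram) (k : ℕ) (D′ : Diagram) : Set where
  field
    1≤k    : 1 ≤ k
    row-k  : row D k ≡ suc (row D′ k)
    row-≢k : ∀ x → x ≢ k → 1 ≤ x → row D′ x ≡ row D x

removal⇒lastCellRemoved : ∀ D D′ k c → IsRemoval D (k , c) D′ → (k , c) ∈ cells D →
                          c ≡ row D k × LastCellRemoved D k D′
removal⇒lastCellRemoved D D′ k c isRem kc∈D with ∈-cells⁻ D kc∈D
... | 1≤k , 1≤c , c≤row = c≡row , record { 1≤k = 1≤k ; row-k = row-k ; row-≢k = row-≢k }
  where
  open Equivalence
  row-⇔ : ∀ x y → 1 ≤ x → 1 ≤ y → y ≤ row D′ x ⇔ (y ≤ row D x × (x ,′ y) ≢ (k , c))
  row-⇔ x y 1≤x 1≤y = mk⇔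
    (λ y≤ → let y∈D , xy≢kc = to (isRem (x , y)) (∈-cells⁺ D′ 1≤x 1≤y y≤) in proj₂ (proj₂ (∈-cells⁻ D y∈D)) , xy≢kc)
    (λ (y≤ , xy≢kc) → proj₂ (proj₂ (∈-cells⁻ D′ (from (isRem (x , y)) (∈-cells⁺ D 1≤x 1≤y y≤ , xy≢kc)))))
  row-≢k : ∀ x → x ≢ k → 1 ≤ x → row D′ x ≡ row D x
  row-≢k x x≢k 1≤x = ≡-from-segments λ y 1≤y →
    mk⇔ (proj₁ ∘ to (row-⇔ x y 1≤x 1≤y)) (λ y≤ → from (row-⇔ x y 1≤x 1≤y) (y≤ , x≢k ∘ cong proj₁))
  row-k-minus-c : ∀ y → 1 ≤ y → (y ≤ row D′ k ⇔ (y ≤ row D k × y ≢ c))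
  row-k-minus-c y 1≤y = mk⇔
    (λ y≤ → let y≤′ , ky≢kc = to (row-⇔ k y 1≤k 1≤y) y≤ in y≤′ , ky≢kc ∘ cong (k ,_))
    (λ (y≤ , y≢c) → from (row-⇔ k y 1≤k 1≤y) (y≤ , y≢c ∘ cong proj₂))
  c≡row : c ≡ row D k
  c≡row = proj₁ (segment-minus-point 1≤c c≤row row-k-minus-c)
  row-k : row D k ≡ suc (row D′ k)
  row-k = proj₂ (segment-minus-point 1≤c c≤row row-k-minus-c)

lastCellRemoved⇒removal : ∀ D D′ k → LastCellRemoved D k D′ → IsRemoval D (k , row D k) D′ × (k , row D k) ∈ cells D
lastCellRemoved⇒removal D D′ k rem = isRem , ∈-cells⁺ D 1≤k (subst (1 ≤_) (sym row-k) (s≤s z≤n)) ≤-refl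
  where
  open LastCellRemoved rem
  isRem : IsRemoval D (k , row D k) D′
  isRem (x , y) = mk⇔ fwd bwd
    where
    fwd : (x , y) ∈ cells D′ → (x , y) ∈ cells D × (x , y) ≢ (k , row D k)
    fwd xy∈D′ with ∈-cells⁻ D′ xy∈D′ | x ≟ k
    ... | 1≤x , 1≤y , y≤ | yes refl =
          ∈-cells⁺ D 1≤x 1≤y (≤-trans y≤ (subst (row D′ k ≤_) (sym row-k) (n≤1+n _))) ,
          λ xy≡ → <-irrefl (cong proj₂ xy≡) (≤-<-trans y≤ (subst (row D′ k <_) (sym row-k) ≤-refl))
    ... | 1≤x , 1≤y , y≤ | no x≢k = ∈-cells⁺ D 1≤x 1≤y (subst (y ≤_) (row-≢k x x≢k 1≤x) y≤) , x≢k ∘ cong proj₁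
    bwd : (x , y) ∈ cells D × (x , y) ≢ (k , row D k) → (x , y) ∈ cells D′
    bwd (xy∈D , xy≢) with ∈-cells⁻ D xy∈D | x ≟ k
    ... | 1≤x , 1≤y , y≤ | yes refl = ∈-cells⁺ D′ 1≤x 1≤y (s≤s⁻¹ (subst (y <_) row-k (≤∧≢⇒< y≤ (xy≢ ∘ cong (x ,_)))))
    ... | 1≤x , 1≤y , y≤ | no x≢k   = ∈-cells⁺ D′ 1≤x 1≤y (subst (y ≤_) (sym (row-≢k x x≢k 1≤x)) y≤)

count-lastCellRemoved : ∀ D D′ k → LastCellRemoved D k D′ → ∀ p →
                        count p (cells D) ≡ count p (cells D′) + 𝟙 (p (k , row D k))
count-lastCellRemoved D D′ (suc k) rem p = begin
  count p (cells D)                                          ≡⟨ count-cellsFrom p 1 D n (m≤m+n _ _) ⟩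
  ∑[ i < n ] countRow p (suc i) (nthRow D i)                 ≡⟨ ∑<-update n k _ k<n row-k-count rows-≢k ⟩
  ∑[ i < n ] countRow p (suc i) (nthRow D′ i) + 𝟙 (p P)      ≡⟨ cong (_+ 𝟙 (p P)) (count-cellsFrom p 1 D′ n (m≤n+m _ _)) ⟨
  count p (cells D′) + 𝟙 (p P)                               ∎
  where
  open ≡-Reasoning
  open LastCellRemoved rem
  n : ℕ
  n = length D + length D′
  P : Cell
  P = (suc k , row D (suc k))
  k<n : k < n
  k<n = ≤-trans (row-pos⇒≤length D (suc k) (subst (1 ≤_) (sym row-k) (s≤s z≤n))) (m≤m+n _ _)
  row-k-count : countRow p (suc k) (nthRow D k) ≡ countRow p (suc k) (nthRow D′ k) + 𝟙 (p P)
  row-k-count = begin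
    countRow p (suc k) (nthRow D k)                                      ≡⟨ cong (countRow p (suc k)) row-k ⟩
    countRow p (suc k) (suc (nthRow D′ k))                               ≡⟨ ∑<-suc (nthRow D′ k) _ ⟩
    countRow p (suc k) (nthRow D′ k) + 𝟙 (p (suc k , suc (nthRow D′ k)))  ≡⟨ cong (λ l → _ + 𝟙 (p (suc k , l))) row-k ⟨
    countRow p (suc k) (nthRow D′ k) + 𝟙 (p P)                           ∎
  rows-≢k : ∀ i → i < n → i ≢ k → countRow p (suc i) (nthRow D i) ≡ countRow p (suc i) (nthRow D′ i)
  rows-≢k i _ i≢k = cong (countRow p (suc i)) (sym (row-≢k (suc i) (i≢k ∘ suc-injective) (s≤s z≤n)))

ν-lastCellRemoved : ∀ d D D′ k → LastCellRemoved D k D′ → ∀ j →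
                    ν d j D ≡ ν d j D′ + 𝟙 (inQuadrant d j (k , row D k))
ν-lastCellRemoved d D D′ k rem j = count-lastCellRemoved D D′ k rem (inQuadrant d j)

update : (ℕ → ℕ) → ℕ → ℕ → ℕ → ℕ
update f k v x with x ≟ k
... | yes _ = v
... | no  _ = f x

update-≡ : ∀ f k v → update f k v k ≡ v
update-≡ f k v with k ≟ k
... | yes _   = refl
... | no  k≢k = contradiction refl k≢k

update-≢ : ∀ f k v x → x ≢ k → update f k v x ≡ f x
update-≢ f k v x x≢k with x ≟ k
... | yes x≡k = contradiction x≡k x≢k
... | no  _   = refl

setRow : Diagram → ℕ → ℕ → Diagram
setRow D k v = fromRows (λ i → update (row D) k v (suc i)) (k + length D)

module _ (D : Diagram) (fer : IsFerrers D) (k v : ℕ) (1≤k : 1 ≤ k)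
         (v≤above : 2 ≤ k → v ≤ row D (k ∸ 1)) (below≤v : row D (suc k) ≤ v) where

  private
    g : ℕ → ℕ
    g i = update (row D) k v (suc i)

    g-antitone : Antitone g
    g-antitone i with suc (suc i) ≟ k | suc i ≟ k
    ... | yes refl | yes 1+i≡2+i = contradiction (sym 1+i≡2+i) 1+n≢n
    ... | yes refl | no  _       = v≤above (s≤s (s≤s z≤n))
    ... | no  _    | yes refl    = below≤v
    ... | no  _    | no  _       = row-antitone D fer (s≤s z≤n) (n≤1+n _)

    g-beyond : ∀ i → k + length D ≤ i → g i ≡ 0
    g-beyond i k+len≤i = trans (update-≢ (row D) k v (suc i) 1+i≢k) (nthRow-beyond D (≤-trans (m≤n+m _ k) k+len≤i))
      where
      1+i≢k : suc i ≢ k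
      1+i≢k 1+i≡k = <⇒≢ (s≤s (≤-trans (m≤m+n k _) k+len≤i)) (sym 1+i≡k)

  setRow-ferrers : IsFerrers (setRow D k v)
  setRow-ferrers = fromRows-ferrers (k + length D) g g-antitone

  row-setRow : ∀ x → 1 ≤ x → row (setRow D k v) x ≡ update (row D) k v x
  row-setRow (suc i) _ = nthRow-fromRows (k + length D) g g-antitone g-beyond i

  setRow-lastCellRemoved : row D k ≡ suc v → LastCellRemoved D k (setRow D k v)
  setRow-lastCellRemoved row-k≡1+v = record
    { 1≤k    = 1≤k
    ; row-k  = trans row-k≡1+v (cong suc (sym (trans (row-setRow k 1≤k) (update-≡ (row D) k v))))
    ; row-≢k = λ x x≢k 1≤x → trans (row-setRow x 1≤x) (update-≢ (row D) k v x x≢k)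
    }

  setRow-lastCellAdded : v ≡ suc (row D k) → LastCellRemoved (setRow D k v) k D
  setRow-lastCellAdded v≡1+row-k = record
    { 1≤k    = 1≤k
    ; row-k  = trans (trans (row-setRow k 1≤k) (update-≡ (row D) k v)) v≡1+row-k
    ; row-≢k = λ x x≢k 1≤x → sym (trans (row-setRow x 1≤x) (update-≢ (row D) k v x x≢k))
    }

inQuadrant-true : ∀ d j {x y} → d ∸ j ≤ x → j < y → inQuadrant d j (x , y) ≡ true
inQuadrant-true d j d∸j≤x j<y rewrite ≤ᵇ-true d∸j≤x | ≤ᵇ-true j<y = refl

inQuadrant-false-row : ∀ d j {x y} → x < d ∸ j → inQuadrant d j (x , y) ≡ false
inQuadrant-false-row d j x<d∸j rewrite ≤ᵇ-false x<d∸j = refl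

inQuadrant-false-column : ∀ d j {x y} → y ≤ j → inQuadrant d j (x , y) ≡ false
inQuadrant-false-column d j y≤j rewrite ≤ᵇ-false (s≤s y≤j) = ∧-zeroʳ _


-- Consequences of irreducibility

module _ {d : ℕ} {D : Diagram} (fer : IsFerrers D) (irr : Irreducible d D) (1≤d : 1 ≤ d) where

  private
    νm : ℕ
    νm = νmin d D

  -- Adding a cell that lies in every minimal quadrant would raise νmin: an arrow into D.
  addable-cell-misses-a-minimal-quadrant :
    ∀ k → 1 ≤ k → (2 ≤ k → row D k < row D (k ∸ 1)) →
    ¬ (∀ j → j < d → ν d j D ≡ νm → inQuadrant d j (k , suc (row D k)) ≡ true)
  addable-cell-misses-a-minimal-quadrant k 1≤k addable inAll =
    irr D′ fer′ (inj₂ ((k , row D′ k) , P∈D′ , isRem , νm≢νm′))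
    where
    D′ : Diagram
    D′ = setRow D k (suc (row D k))
    below≤ : row D (suc k) ≤ suc (row D k)
    below≤ = ≤-trans (row-antitone D fer 1≤k (n≤1+n k)) (n≤1+n _)
    fer′ : IsFerrers D′
    fer′ = setRow-ferrers D fer k _ 1≤k addable below≤
    added : LastCellRemoved D′ k D
    added = setRow-lastCellAdded D fer k _ 1≤k addable below≤ refl
    isRem : IsRemoval D′ (k , row D′ k) D
    isRem = proj₁ (lastCellRemoved⇒removal D′ D k added)
    P∈D′ : (k , row D′ k) ∈ cells D′
    P∈D′ = proj₂ (lastCellRemoved⇒removal D′ D k added)
    νm<ν′ : ∀ j → j < d → suc νm ≤ ν d j D′
    νm<ν′ j j<d with ν d j D ≟ νm
    ... | yes νj≡νm = ≤-reflexive (sym (begin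
          ν d j D′                                             ≡⟨ ν-lastCellRemoved d D′ D k added j ⟩
          ν d j D + 𝟙 (inQuadrant d j (k , row D′ k))
                                                       ≡⟨ cong (λ c → ν d j D + 𝟙 (inQuadrant d j (k , c))) (LastCellRemoved.row-k added) ⟩
          ν d j D + 𝟙 (inQuadrant d j (k , suc (row D k)))     ≡⟨ cong₂ (λ ν b → ν + 𝟙 b) νj≡νm (inAll j j<d νj≡νm) ⟩
          νm + 1                                               ≡⟨ +-comm νm 1 ⟩
          suc νm                                               ∎))
      where open ≡-Reasoning
    ... | no  νj≢νm = ≤-trans (≤∧≢⇒< (νmin-≤ d D j j<d) (νj≢νm ∘ sym))
                              (≤-trans (m≤m+n _ _) (≤-reflexive (sym (ν-lastCellRemoved d D′ D k added j))))
    νm≢νm′ : νm ≢ νmin d D′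
    νm≢νm′ = <⇒≢ (νmin-greatest d D′ (suc νm) 1≤d νm<ν′)

  -- Removing a corner that lies in no minimal quadrant would keep νmin: an arrow into D.
  corner-meets-a-minimal-quadrant :
    ∀ k → 1 ≤ k → row D (suc k) < row D k →
    ¬ (∀ j → j < d → ν d j D ≡ νm → inQuadrant d j (k , row D k) ≡ false)
  corner-meets-a-minimal-quadrant k 1≤k corner inNone =
    irr D′ fer′ (inj₁ ((k , row D k) , P∈D , isRem , νm′≡νm))
    where
    v : ℕ
    v = pred (row D k)
    row-k≡1+v : row D k ≡ suc v
    row-k≡1+v = sym (suc-pred (row D k) {{>-nonZero (≤-<-trans z≤n corner)}})
    v≤above : 2 ≤ k → v ≤ row D (k ∸ 1)
    v≤above 2≤k = ≤-trans pred[n]≤n (row-antitone D fer (∸-monoˡ-≤ 1 2≤k) (m∸n≤m k 1))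
    below≤v : row D (suc k) ≤ v
    below≤v = s≤s⁻¹ (subst (row D (suc k) <_) row-k≡1+v corner)
    D′ : Diagram
    D′ = setRow D k v
    fer′ : IsFerrers D′
    fer′ = setRow-ferrers D fer k v 1≤k v≤above below≤v
    removed : LastCellRemoved D k D′
    removed = setRow-lastCellRemoved D fer k v 1≤k v≤above below≤v row-k≡1+v
    isRem : IsRemoval D (k , row D k) D′
    isRem = proj₁ (lastCellRemoved⇒removal D D′ k removed)
    P∈D : (k , row D k) ∈ cells D
    P∈D = proj₂ (lastCellRemoved⇒removal D D′ k removed)
    ν≡ : ∀ j → ν d j D ≡ ν d j D′ + 𝟙 (inQuadrant d j (k , row D k))
    ν≡ = ν-lastCellRemoved d D D′ k removed
    νm≤ν′ : ∀ j → j < d → νm ≤ ν d j D′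
    νm≤ν′ j j<d with ν d j D ≟ νm
    ... | yes νj≡νm = ≤-reflexive (begin
          νm                                            ≡⟨ νj≡νm ⟨
          ν d j D                                       ≡⟨ ν≡ j ⟩
          ν d j D′ + 𝟙 (inQuadrant d j (k , row D k))   ≡⟨ cong (λ b → ν d j D′ + 𝟙 b) (inNone j j<d νj≡νm) ⟩
          ν d j D′ + 0                                  ≡⟨ +-identityʳ _ ⟩
          ν d j D′                                      ∎)
      where open ≡-Reasoning
    ... | no  νj≢νm = s≤s⁻¹ (begin
          suc νm                                        ≤⟨ ≤∧≢⇒< (νmin-≤ d D j j<d) (νj≢νm ∘ sym) ⟩
          ν d j D                                       ≡⟨ ν≡ j ⟩
          ν d j D′ + 𝟙 (inQuadrant d j (k , row D k))   ≤⟨ +-monoʳ-≤ _ (𝟙≤1 _) ⟩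
          ν d j D′ + 1                                  ≡⟨ +-comm _ 1 ⟩
          suc (ν d j D′)                                ∎)
      where open ≤-Reasoning
    νm′≤νm : νmin d D′ ≤ νm
    νm′≤νm with νmin-attained d D 1≤d
    ... | j , j<d , νm≡νj = ≤-trans (νmin-≤ d D′ j j<d) (≤-trans (m≤m+n _ _) (≤-reflexive (trans (sym (ν≡ j)) (sym νm≡νj))))
    νm′≡νm : νmin d D′ ≡ νm
    νm′≡νm = ≤-antisym νm′≤νm (νmin-greatest d D′ νm 1≤d νm≤ν′)


-- Second differences of ν

no-kink : ∀ v k → v ≤ k ⊎ suc (suc k) ≤ v → (v ∸ k) + (v ∸ suc (suc k)) ≡ (v ∸ suc k) + (v ∸ suc k)
no-kink zero          zero    (inj₁ z≤n)         = refl
no-kink (suc zero)    zero    (inj₂ (s≤s ()))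
no-kink (suc (suc t)) zero    (inj₂ _)           = cong suc (sym (+-suc t t))
no-kink zero          (suc k) _                  = refl
no-kink (suc v)       (suc k) v≤k⊎k+2≤v          = no-kink v k (Sum.map s≤s⁻¹ s≤s⁻¹ v≤k⊎k+2≤v)

νᶠ-peel : ∀ s j f N → s < N → νᶠ s j f N ≡ νᶠ (suc s) j f N + (f (suc s) ∸ j)
νᶠ-peel s j f N s<N = ∑<-update N s _ s<N first rest
  where
  first : 𝟙 (s ≤ᵇ s) * (f (suc s) ∸ j) ≡ 𝟙 (suc s ≤ᵇ s) * (f (suc s) ∸ j) + (f (suc s) ∸ j)
  first rewrite 𝟙-≤ᵇ-1 (≤-refl {s}) | 𝟙-≤ᵇ-0 (n<1+n s) = +-identityʳ _
  rest : ∀ i → i < N → i ≢ s → 𝟙 (s ≤ᵇ i) * (f (suc i) ∸ j) ≡ 𝟙 (suc s ≤ᵇ i) * (f (suc i) ∸ j)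
  rest i _ i≢s = cong (λ b → 𝟙 b * (f (suc i) ∸ j)) (≤ᵇ-cong (mk⇔ (λ s≤i → ≤∧≢⇒< s≤i (i≢s ∘ sym)) <⇒≤))

νᶠ-no-kink : ∀ s k f N → (∀ i → s ≤ i → f (suc i) ≤ k ⊎ suc (suc k) ≤ f (suc i)) →
             νᶠ s k f N + νᶠ s (suc (suc k)) f N ≡ νᶠ s (suc k) f N + νᶠ s (suc k) f N
νᶠ-no-kink s k f N avoids = begin
  νᶠ s k f N + νᶠ s (suc (suc k)) f N        ≡⟨ ∑<-distrib-+ N _ _ ⟨
  ∑[ i < N ] (term k i + term (suc (suc k)) i) ≡⟨ ∑<-cong N (λ i _ → pointwise i) ⟩
  ∑[ i < N ] (term (suc k) i + term (suc k) i) ≡⟨ ∑<-distrib-+ N _ _ ⟩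
  νᶠ s (suc k) f N + νᶠ s (suc k) f N        ∎
  where
  open ≡-Reasoning
  term : ℕ → ℕ → ℕ
  term j i = 𝟙 (s ≤ᵇ i) * (f (suc i) ∸ j)
  pointwise : ∀ i → term k i + term (suc (suc k)) i ≡ term (suc k) i + term (suc k) i
  pointwise i with s ≤? i
  ... | no  s≰i rewrite 𝟙-≤ᵇ-0 (≰⇒> s≰i) = refl
  ... | yes s≤i rewrite 𝟙-≤ᵇ-1 s≤i | *-identityˡ (f (suc i) ∸ k) | *-identityˡ (f (suc i) ∸ suc (suc k))
                      | *-identityˡ (f (suc i) ∸ suc k) = no-kink (f (suc i)) k (avoids i s≤i)

-- Rows past s + 2 avoid the kink of v ↦ v ∸ (k + 1), so only rows s + 1 and s + 2, both of
-- length f (suc s), contribute to the second difference at k + 1, and they contribute −2.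
νᶠ-concave : ∀ N f s k → suc s < N → f (suc s) ≡ f (suc (suc s)) → suc (suc k) ≤ f (suc s) →
             (∀ i → suc (suc s) ≤ i → f (suc i) ≤ k ⊎ suc (suc k) ≤ f (suc i)) →
             νᶠ (suc (suc s)) k f N + νᶠ s (suc (suc k)) f N + 2 ≡ νᶠ (suc s) (suc k) f N + νᶠ (suc s) (suc k) f N
νᶠ-concave N f s k 1+s<N equal long avoids = begin
  τ k + νᶠ s (suc (suc k)) f N + 2               ≡⟨ cong (λ x → τ k + x + 2) ν₊₂ ⟩
  τ k + (τ (suc (suc k)) + w + w) + 2            ≡⟨ regroup (τ k) _ w ⟩
  (τ k + τ (suc (suc k))) + (suc w + suc w)      ≡⟨ cong (_+ (suc w + suc w)) (νᶠ-no-kink (suc (suc s)) k f N avoids) ⟩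
  (τ (suc k) + τ (suc k)) + (suc w + suc w)      ≡⟨ interchange (τ (suc k)) _ _ _ ⟩
  (τ (suc k) + suc w) + (τ (suc k) + suc w)      ≡⟨ cong₂ _+_ ν₊₁ ν₊₁ ⟨
  νᶠ (suc s) (suc k) f N + νᶠ (suc s) (suc k) f N ∎
  where
  open ≡-Reasoning
  τ : ℕ → ℕ
  τ j = νᶠ (suc (suc s)) j f N
  w : ℕ
  w = f (suc s) ∸ suc (suc k)
  regroup : ∀ a b w → a + (b + w + w) + 2 ≡ (a + b) + (suc w + suc w)
  regroup = solve-∀
  row₊₂ : ∀ j → f (suc (suc s)) ∸ j ≡ f (suc s) ∸ j
  row₊₂ j = cong (_∸ j) (sym equal)
  ν₊₂ : νᶠ s (suc (suc k)) f N ≡ τ (suc (suc k)) + w + w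
  ν₊₂ = begin
    νᶠ s (suc (suc k)) f N                                      ≡⟨ νᶠ-peel s (suc (suc k)) f N (<-trans (n<1+n s) 1+s<N) ⟩
    νᶠ (suc s) (suc (suc k)) f N + w                            ≡⟨ cong (_+ w) (νᶠ-peel (suc s) (suc (suc k)) f N 1+s<N) ⟩
    τ (suc (suc k)) + (f (suc (suc s)) ∸ suc (suc k)) + w       ≡⟨ cong (λ x → τ (suc (suc k)) + x + w) (row₊₂ (suc (suc k))) ⟩
    τ (suc (suc k)) + w + w                                     ∎
  ν₊₁ : νᶠ (suc s) (suc k) f N ≡ τ (suc k) + suc w
  ν₊₁ = begin
    νᶠ (suc s) (suc k) f N                    ≡⟨ νᶠ-peel (suc s) (suc k) f N 1+s<N ⟩
    τ (suc k) + (f (suc (suc s)) ∸ suc k)     ≡⟨ cong (_+_ (τ (suc k))) (row₊₂ (suc k)) ⟩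
    τ (suc k) + (f (suc s) ∸ suc k)           ≡⟨ cong (_+_ (τ (suc k))) (+-∸-assoc 1 long) ⟩
    τ (suc k) + suc w                         ∎


record StandardShape (e a b : ℕ) (f : ℕ → ℕ) (N : ℕ) : Set where
  field
    2+e≤a    : suc (suc e) ≤ a
    2+e≤b    : suc (suc e) ≤ b
    a≤N      : a ≤ N
    antitone : ∀ x → 1 ≤ x → f (suc x) ≤ f x
    arm      : ∀ x → 1 ≤ x → x ≤ e → b ≤ f x
    body     : ∀ x → suc e ≤ x → x ≤ a → f x ≡ b
    leg      : ∀ x → a < x → f x ≤ e
    beyond   : ∀ x → N < x → f x ≡ 0

  e≤a : e ≤ a
  e≤a = ≤-trans (n≤1+n e) (<⇒≤ 2+e≤a)

  1+e≤b : suc e ≤ b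
  1+e≤b = <⇒≤ 2+e≤b

  b≤f : ∀ x → 1 ≤ x → x ≤ a → b ≤ f x
  b≤f x 1≤x x≤a with x ≤? e
  ... | yes x≤e = arm x 1≤x x≤e
  ... | no  x≰e = ≤-reflexive (sym (body x (≰⇒> x≰e) x≤a))

-- c_i(X) and c_i(Y) in terms of the row lengths.
cX : (ℕ → ℕ) → ℕ → ℕ → ℕ
cX f b i = f i ∸ b

cY : (ℕ → ℕ) → ℕ → ℕ → ℕ → ℕ
cY f a N i = ∑[ r < N ∸ a ] 𝟙 (i ≤ᵇ f (a + suc r))

armSum : (ℕ → ℕ) → ℕ → ℕ → ℕ → ℕ
armSum f b e j = ∑[ i < j ∸ 1 ] cX f b (e ∸ i)

legSum : (ℕ → ℕ) → ℕ → ℕ → ℕ → ℕ → ℕ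
legSum f a N e j = ∑[ i < e ] (𝟙 (j ≤ᵇ i) * cY f a N (suc i))

∸-≤-∸⇔ : ∀ e i j → i < e → (e ∸ j ≤ e ∸ suc i ⇔ suc i ≤ j)
∸-≤-∸⇔ e i j i<e = mk⇔ to (∸-monoʳ-≤ e)
  where
  to : e ∸ j ≤ e ∸ suc i → suc i ≤ j
  to e∸j≤ with suc i ≤? j
  ... | yes i<j = i<j
  ... | no  i≮j = contradiction e∸j≤ (<⇒≱ (<-≤-trans (∸-monoʳ-< (n<1+n i) i<e) (∸-monoʳ-≤ e (≮⇒≥ i≮j))))

1+m≤n∸1⇒2+m≤n : ∀ {m n} → suc m ≤ n ∸ 1 → suc (suc m) ≤ n
1+m≤n∸1⇒2+m≤n {n = suc n} 1+m≤n = s≤s 1+m≤n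

m∸[1+m∸n]≡n∸1 : ∀ m n → n ≤ suc m → m ∸ (suc m ∸ n) ≡ n ∸ 1
m∸[1+m∸n]≡n∸1 m zero    _         = m≤n⇒m∸n≡0 (n≤1+n m)
m∸[1+m∸n]≡n∸1 m (suc n) (s≤s n≤m) = m∸[m∸n]≡n n≤m

module _ {e a b : ℕ} {D : Diagram} where
  open Equivalence

  standardForm⇒shape : IsFerrers D → StandardForm (suc (suc e)) D a b →
                       suc (suc e) ≤ a → suc (suc e) ≤ b → StandardShape e a b (row D) (length D)
  standardForm⇒shape fer (_ , _ , sf) 2+e≤a 2+e≤b = record
    { 2+e≤a = 2+e≤a ; 2+e≤b = 2+e≤b ; a≤N = a≤L
    ; antitone = λ x 1≤x → row-antitone D fer 1≤x (n≤1+n x)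
    ; arm = arm ; body = body ; leg = leg
    ; beyond = λ x L<x → row-beyond D L<x }
    where
    1+e≤a : suc e ≤ a
    1+e≤a = <⇒≤ 2+e≤a
    1+e≤b : suc e ≤ b
    1+e≤b = <⇒≤ 2+e≤b
    body : ∀ x → suc e ≤ x → x ≤ a → row D x ≡ b
    body x 1+e≤x x≤a = ≤-antisym (≮⇒≥ b≮row) b≤row
      where
      b≤row : b ≤ row D x
      b≤row = proj₂ (proj₂ (∈-cells⁻ D (from (sf x b 1+e≤x 1+e≤b) (x≤a , ≤-refl))))
      b≮row : ¬ b < row D x
      b≮row b<row = 1+n≰n (proj₂ (to (sf x (suc b) 1+e≤x (≤-trans 1+e≤b (n≤1+n b)))
                                      (∈-cells⁺ D (≤-trans (s≤s z≤n) 1+e≤x) (s≤s z≤n) b<row)))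
    arm : ∀ x → 1 ≤ x → x ≤ e → b ≤ row D x
    arm x 1≤x x≤e = subst (_≤ row D x) (body (suc e) ≤-refl 1+e≤a) (row-antitone D fer 1≤x (≤-trans x≤e (n≤1+n e)))
    leg : ∀ x → a < x → row D x ≤ e
    leg x a<x = ≮⇒≥ λ e<row → <⇒≱ a<x (proj₁ (to (sf x (suc e) (≤-trans 1+e≤a (<⇒≤ a<x)) ≤-refl)
                                                  (∈-cells⁺ D (≤-trans (s≤s z≤n) a<x) (s≤s z≤n) e<row)))
    a≤L : a ≤ length D
    a≤L = row-pos⇒≤length D a (subst (1 ≤_) (sym (body a 1+e≤a ≤-refl)) (≤-trans (s≤s z≤n) 2+e≤b))

  shape⇒standardForm : ∀ {N} → StandardShape e a b (row D) N → StandardForm (suc (suc e)) D a b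
  shape⇒standardForm sh = <⇒≤ 2+e≤a , <⇒≤ 2+e≤b , λ x y 1+e≤x 1+e≤y → mk⇔ (into x y 1+e≤x 1+e≤y) (outof x y 1+e≤x 1+e≤y)
    where
    open StandardShape sh
    into : ∀ x y → suc e ≤ x → suc e ≤ y → (x , y) ∈ cells D → x ≤ a × y ≤ b
    into x y 1+e≤x 1+e≤y xy∈D with ∈-cells⁻ D xy∈D | x ≤? a
    ... | _ , _ , y≤row | yes x≤a = x≤a , subst (y ≤_) (body x 1+e≤x x≤a) y≤row
    ... | _ , _ , y≤row | no  x≰a = contradiction (≤-trans 1+e≤y (≤-trans y≤row (leg x (≰⇒> x≰a)))) 1+n≰n
    outof : ∀ x y → suc e ≤ x → suc e ≤ y → x ≤ a × y ≤ b → (x , y) ∈ cells D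
    outof x y 1+e≤x 1+e≤y (x≤a , y≤b) =
      ∈-cells⁺ D (≤-trans (s≤s z≤n) 1+e≤x) (≤-trans (s≤s z≤n) 1+e≤y) (subst (y ≤_) (sym (body x 1+e≤x x≤a)) y≤b)

standardForm-≤ : ∀ d D {a b a′ b′} → StandardForm d D a b → StandardForm d D a′ b′ → a ≤ a′ × b ≤ b′
standardForm-≤ d D {a} {b} (d-1≤a , d-1≤b , sf) (_ , _ , sf′) =
  proj₁ (to (sf′ a (d ∸ 1) d-1≤a ≤-refl) (from (sf a (d ∸ 1) d-1≤a ≤-refl) (≤-refl , d-1≤b))) ,
  proj₂ (to (sf′ (d ∸ 1) b ≤-refl d-1≤b) (from (sf (d ∸ 1) b ≤-refl d-1≤b) (d-1≤a , ≤-refl)))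
  where open Equivalence

standardForm-unique : ∀ d D {a b a′ b′} → StandardForm d D a b → StandardForm d D a′ b′ → a ≡ a′ × b ≡ b′
standardForm-unique d D sf sf′ =
  ≤-antisym (proj₁ (standardForm-≤ d D sf sf′)) (proj₁ (standardForm-≤ d D sf′ sf)) ,
  ≤-antisym (proj₂ (standardForm-≤ d D sf sf′)) (proj₂ (standardForm-≤ d D sf′ sf))

module νFormula {e a b f N} (sh : StandardShape e a b f N) where
  open StandardShape sh

  term : ℕ → ℕ → ℕ
  term j i = 𝟙 (suc e ∸ j ≤ᵇ i) * (f (suc i) ∸ j)

  armPart : ∀ j → j ≤ suc e → ∑[ i < e ] term j i ≡ (j ∸ 1) * (b ∸ j) + armSum f b e j
  armPart j j≤1+e = begin
    ∑[ i < e ] term j i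
      ≡⟨ ∑<-cong e split ⟩
    ∑[ i < e ] (𝟙 (s ≤ᵇ i) * (b ∸ j) + 𝟙 (s ≤ᵇ i) * cX f b (suc i))
      ≡⟨ ∑<-distrib-+ e _ _ ⟩
    ∑[ i < e ] (𝟙 (s ≤ᵇ i) * (b ∸ j)) + ∑[ i < e ] (𝟙 (s ≤ᵇ i) * cX f b (suc i))
      ≡⟨ cong₂ _+_ (trans (∑<-*ʳ e (b ∸ j) _) (cong (_* (b ∸ j)) (trans (∑<-count-≥ e s) counted))) reversed ⟩
    (j ∸ 1) * (b ∸ j) + armSum f b e j
      ∎
    where
    open ≡-Reasoning
    s : ℕ
    s = suc e ∸ j
    split : ∀ i → i < e → term j i ≡ 𝟙 (s ≤ᵇ i) * (b ∸ j) + 𝟙 (s ≤ᵇ i) * cX f b (suc i)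
    split i i<e = begin
      𝟙 (s ≤ᵇ i) * (f (suc i) ∸ j)
        ≡⟨ cong (λ l → 𝟙 (s ≤ᵇ i) * (l ∸ j)) (m+[n∸m]≡n (arm (suc i) (s≤s z≤n) i<e)) ⟨
      𝟙 (s ≤ᵇ i) * (b + cX f b (suc i) ∸ j)              ≡⟨ cong (𝟙 (s ≤ᵇ i) *_) (+-∸-comm _ (≤-trans j≤1+e 1+e≤b)) ⟩
      𝟙 (s ≤ᵇ i) * (b ∸ j + cX f b (suc i))              ≡⟨ *-distribˡ-+ (𝟙 (s ≤ᵇ i)) _ _ ⟩
      𝟙 (s ≤ᵇ i) * (b ∸ j) + 𝟙 (s ≤ᵇ i) * cX f b (suc i) ∎
    counted : e ∸ s ≡ j ∸ 1
    counted = m∸[1+m∸n]≡n∸1 e j j≤1+e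
    j∸1≤e : j ∸ 1 ≤ e
    j∸1≤e = ∸-monoˡ-≤ 1 j≤1+e
    reversed : ∑[ i < e ] (𝟙 (s ≤ᵇ i) * cX f b (suc i)) ≡ armSum f b e j
    reversed = begin
      ∑[ i < e ] (𝟙 (s ≤ᵇ i) * cX f b (suc i))                         ≡⟨ ∑<-reverse e _ ⟨
      ∑[ i < e ] (𝟙 (s ≤ᵇ e ∸ suc i) * cX f b (suc (e ∸ suc i)))       ≡⟨ ∑<-cong e mirror ⟩
      ∑[ i < e ] (𝟙 (suc i ≤ᵇ j ∸ 1) * cX f b (e ∸ i))                 ≡⟨ ∑<-prefix e (j ∸ 1) _ j∸1≤e ⟩
      armSum f b e j                                                   ∎
      where
      mirror : ∀ i → i < e → 𝟙 (s ≤ᵇ e ∸ suc i) * cX f b (suc (e ∸ suc i)) ≡ 𝟙 (suc i ≤ᵇ j ∸ 1) * cX f b (e ∸ i)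
      mirror i i<e = cong₂ (λ c x → 𝟙 c * cX f b x) (≤ᵇ-cong (condition j j≤1+e)) (sym (+-∸-assoc 1 i<e))
        where
        condition : ∀ j → j ≤ suc e → (suc e ∸ j ≤ e ∸ suc i ⇔ suc i ≤ j ∸ 1)
        condition zero    _         = mk⇔ (λ 1+e≤ → contradiction (≤-trans 1+e≤ (m∸n≤m e (suc i))) 1+n≰n) (λ ())
        condition (suc j) (s≤s j≤e) = ∸-≤-∸⇔ e i j i<e

  bodyPart : ∀ j → j ≤ suc e → ∑[ r < a ∸ e ] term j (e + r) ≡ ((a ∸ e) ∸ (1 ∸ j)) * (b ∸ j)
  bodyPart j j≤1+e = begin
    ∑[ r < a ∸ e ] term j (e + r)               ≡⟨ ∑<-cong (a ∸ e) row-b ⟩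
    ∑[ r < a ∸ e ] (𝟙 (1 ∸ j ≤ᵇ r) * (b ∸ j))   ≡⟨ ∑<-*ʳ (a ∸ e) (b ∸ j) _ ⟩
    ∑[ r < a ∸ e ] 𝟙 (1 ∸ j ≤ᵇ r) * (b ∸ j)     ≡⟨ cong (_* (b ∸ j)) (∑<-count-≥ (a ∸ e) (1 ∸ j)) ⟩
    ((a ∸ e) ∸ (1 ∸ j)) * (b ∸ j)               ∎
    where
    open ≡-Reasoning
    starts : ∀ j r → (suc e ∸ j ≤ e + r ⇔ 1 ∸ j ≤ r)
    starts zero    r = mk⇔ (λ 1+e≤e+r → +-cancelˡ-≤ e 1 r (subst (_≤ e + r) (+-comm 1 e) 1+e≤e+r))
                           (λ 1≤r → subst (_≤ e + r) (+-comm e 1) (+-monoʳ-≤ e 1≤r))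
    starts (suc j) r = mk⇔ (λ _ → subst (_≤ r) (sym (0∸n≡0 j)) z≤n) (λ _ → ≤-trans (m∸n≤m e j) (m≤m+n e r))
    row-b : ∀ r → r < a ∸ e → term j (e + r) ≡ 𝟙 (1 ∸ j ≤ᵇ r) * (b ∸ j)
    row-b r r<a∸e = cong₂ (λ c l → 𝟙 c * (l ∸ j)) (≤ᵇ-cong (starts j r)) (body (suc (e + r)) (s≤s (m≤m+n e r)) 1+e+r≤a)
      where
      1+e+r≤a : suc (e + r) ≤ a
      1+e+r≤a = subst₂ _≤_ (+-suc e r) (m+[n∸m]≡n e≤a) (+-monoʳ-≤ e r<a∸e)

  legPart : ∀ j → ∑[ r < N ∸ a ] term j (a + r) ≡ legSum f a N e j
  legPart j = begin
    ∑[ r < N ∸ a ] term j (a + r)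
      ≡⟨ ∑<-cong (N ∸ a) (λ r _ → leg-row r) ⟩
    ∑[ r < N ∸ a ] ∑[ i < e ] (𝟙 (j ≤ᵇ i) * 𝟙 (suc i ≤ᵇ f (a + suc r)))
      ≡⟨ ∑<-comm (N ∸ a) e _ ⟩
    ∑[ i < e ] ∑[ r < N ∸ a ] (𝟙 (j ≤ᵇ i) * 𝟙 (suc i ≤ᵇ f (a + suc r)))
      ≡⟨ ∑<-cong e (λ i _ → ∑<-*ˡ (N ∸ a) (𝟙 (j ≤ᵇ i)) _) ⟩
    legSum f a N e j
      ∎
    where
    open ≡-Reasoning
    leg-row : ∀ r → term j (a + r) ≡ ∑[ i < e ] (𝟙 (j ≤ᵇ i) * 𝟙 (suc i ≤ᵇ f (a + suc r)))
    leg-row r = begin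
      𝟙 (suc e ∸ j ≤ᵇ a + r) * (f (suc (a + r)) ∸ j)   ≡⟨ cong (_* (f (suc (a + r)) ∸ j)) (𝟙-≤ᵇ-1 counted) ⟩
      (f (suc (a + r)) ∸ j) + 0                         ≡⟨ +-identityʳ _ ⟩
      f (suc (a + r)) ∸ j                               ≡⟨ cong (λ x → f x ∸ j) (+-suc a r) ⟨
      f (a + suc r) ∸ j                                 ≡⟨ ∸-as-∑ e (f (a + suc r)) j (leg (a + suc r) (m<m+n a z<s)) ⟩
      ∑[ i < e ] (𝟙 (j ≤ᵇ i) * 𝟙 (suc i ≤ᵇ f (a + suc r))) ∎
      where
      counted : suc e ∸ j ≤ a + r
      counted = ≤-trans (m∸n≤m (suc e) j) (≤-trans (<⇒≤ 2+e≤a) (m≤m+n a r))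

  formula : ∀ j → j ≤ suc e →
            νᶠ (suc e ∸ j) j f N ≡ (j ∸ 1) * (b ∸ j) + armSum f b e j + ((a ∸ e) ∸ (1 ∸ j)) * (b ∸ j) + legSum f a N e j
  formula j j≤1+e = begin
    ∑< N (term j)                                         ≡⟨ cong (λ n → ∑< n (term j)) (m+[n∸m]≡n a≤N) ⟨
    ∑< (a + (N ∸ a)) (term j)                             ≡⟨ ∑<-+ a (N ∸ a) (term j) ⟩
    ∑< a (term j) + legTerms                              ≡⟨ cong (λ n → ∑< n (term j) + legTerms) (m+[n∸m]≡n e≤a) ⟨
    ∑< (e + (a ∸ e)) (term j) + legTerms                  ≡⟨ cong (_+ legTerms) (∑<-+ e (a ∸ e) (term j)) ⟩
    ∑< e (term j) + ∑[ r < a ∸ e ] term j (e + r) + ∑[ r < N ∸ a ] term j (a + r)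
      ≡⟨ cong₂ _+_ (cong₂ _+_ (armPart j j≤1+e) (bodyPart j j≤1+e)) (legPart j) ⟩
    (j ∸ 1) * (b ∸ j) + armSum f b e j + ((a ∸ e) ∸ (1 ∸ j)) * (b ∸ j) + legSum f a N e j ∎
    where
    open ≡-Reasoning
    legTerms : ℕ
    legTerms = ∑[ r < N ∸ a ] term j (a + r)

module 𝔓Conditions {e a b f N} (sh : StandardShape e a b f N) (xv yv : Vec ℤ e)
  (xv≡cX : ∀ i → i < e → at xv (suc i) ≡ + cX f b (suc i))
  (yv≡cY : ∀ i → i < e → at yv (suc i) ≡ + cY f a N (suc i)) where

  open StandardShape sh
  open νFormula sh using (formula)

  νs : ℕ → ℕ
  νs j = νᶠ (suc e ∸ j) j f N

  A : ℕ
  A = a ∸ suc e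

  a∸e≡1+A : a ∸ e ≡ suc A
  a∸e≡1+A = +-∸-assoc 1 (<⇒≤ 2+e≤a)

  a≡e+1+A : a ≡ e + suc A
  a≡e+1+A = trans (sym (m+[n∸m]≡n e≤a)) (cong (_+_ e) a∸e≡1+A)

  legPrefix : ℕ → ℕ
  legPrefix j = ∑[ i < j ] cY f a N (suc i)

  legSum-split : ∀ j → j ≤ e → legSum f a N e 0 ≡ legPrefix j + legSum f a N e j
  legSum-split j j≤e = begin
    ∑[ i < e ] (1 * y i)                                   ≡⟨ ∑<-cong e (λ i _ → either i) ⟩
    ∑[ i < e ] (𝟙 (suc i ≤ᵇ j) * y i + 𝟙 (j ≤ᵇ i) * y i)   ≡⟨ ∑<-distrib-+ e _ _ ⟩
    ∑[ i < e ] (𝟙 (suc i ≤ᵇ j) * y i) + legSum f a N e j   ≡⟨ cong (_+ legSum f a N e j) (∑<-prefix e j y j≤e) ⟩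
    legPrefix j + legSum f a N e j                         ∎
    where
    open ≡-Reasoning
    y : ℕ → ℕ
    y i = cY f a N (suc i)
    either : ∀ i → 1 * y i ≡ 𝟙 (suc i ≤ᵇ j) * y i + 𝟙 (j ≤ᵇ i) * y i
    either i with j ≤? i
    ... | yes j≤i rewrite 𝟙-≤ᵇ-0 (s≤s j≤i) | 𝟙-≤ᵇ-1 j≤i = refl
    ... | no  j≰i rewrite 𝟙-≤ᵇ-1 (≰⇒> j≰i) | 𝟙-≤ᵇ-0 (≰⇒> j≰i) = sym (+-identityʳ _)

  ν₀-formula : νs 0 ≡ A * b + legSum f a N e 0
  ν₀-formula = trans (formula 0 z≤n) (cong (λ n → (n ∸ 1) * b + legSum f a N e 0) a∸e≡1+A)

  ν-suc-formula : ∀ j → j ≤ e →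
          νs (suc j) ≡ j * (b ∸ suc j) + armSum f b e (suc j) + suc A * (b ∸ suc j) + legSum f a N e (suc j)
  ν-suc-formula j j≤e = trans (formula (suc j) (s≤s j≤e))
    (cong (λ n → j * (b ∸ suc j) + armSum f b e (suc j) + n * (b ∸ suc j) + legSum f a N e (suc j))
          (trans (cong ((a ∸ e) ∸_) (0∸n≡0 j)) a∸e≡1+A))

  -- The j-th inequality of 𝔓_d reads 0 ≤ E z j, since d ∸ 1 = suc e and d ∸ 2 = e.
  E : ℤ → ℕ → ℤ
  E z j = ((+ j) ℤ.* ((z ℤ.+ (+ suc e)) - (+ j)) ℤ.+ sumℤ (map (λ i → at xv (e ∸ i)) (upTo (j ∸ 1))))
          - sumℤ (map (λ i → at yv (suc i)) (upTo j))

  armSum-ℤ : ∀ j → suc j ≤ e → sumℤ (map (λ i → at xv (e ∸ i)) (upTo j)) ≡ + armSum f b e (suc j)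
  armSum-ℤ j 1+j≤e = sumℤ-map-upTo j _ _ mirrored
    where
    mirrored : ∀ i → i < j → at xv (e ∸ i) ≡ + cX f b (e ∸ i)
    mirrored i i<j = begin
      at xv (e ∸ i)                  ≡⟨ cong (at xv) e∸i≡1+e∸1+i ⟩
      at xv (suc (e ∸ suc i))        ≡⟨ xv≡cX (e ∸ suc i) (∸-monoʳ-< z<s i<e) ⟩
      + cX f b (suc (e ∸ suc i))     ≡⟨ cong (λ x → + cX f b x) e∸i≡1+e∸1+i ⟨
      + cX f b (e ∸ i)               ∎
      where
      open ≡-Reasoning
      i<e : i < e
      i<e = <-trans i<j 1+j≤e
      e∸i≡1+e∸1+i : e ∸ i ≡ suc (e ∸ suc i)
      e∸i≡1+e∸1+i = +-∸-assoc 1 i<e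

  legPrefix-ℤ : ∀ j → j ≤ e → sumℤ (map (λ i → at yv (suc i)) (upTo j)) ≡ + legPrefix j
  legPrefix-ℤ j j≤e = sumℤ-map-upTo j _ _ (λ i i<j → yv≡cY i (<-≤-trans i<j j≤e))

  E≡νs-difference : ∀ j → suc j ≤ e → E (+ b - + a) (suc j) ≡ + νs (suc j) - + νs 0
  E≡νs-difference j 1+j≤e = begin
    E (+ b - + a) (suc j)
      ≡⟨ cong₂ (λ x y → (+ suc j ℤ.* ((+ b - + a ℤ.+ + suc e) - + suc j) ℤ.+ x) - y)
               (armSum-ℤ j 1+j≤e) (legPrefix-ℤ (suc j) 1+j≤e) ⟩
    (+ suc j ℤ.* ((+ b - + a ℤ.+ + suc e) - + suc j) ℤ.+ + X) - + Yp
      ≡⟨ cong₂ (λ β α → (+ suc j ℤ.* ((β - α ℤ.+ + suc e) - + suc j) ℤ.+ + X) - + Yp)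
               (+-split (suc j) B b≡1+j+B) (+-split e (suc A) a≡e+1+A) ⟩
    (+ suc j ℤ.* (((+ suc j ℤ.+ + B) - (+ e ℤ.+ (+ 1 ℤ.+ + A)) ℤ.+ (+ 1 ℤ.+ + e)) - + suc j) ℤ.+ + X) - + Yp
      ≡⟨ regroup (+ suc j) (+ B) (+ e) (+ A) (+ X) (+ Yp) ⟩
    (+ X ℤ.+ + suc j ℤ.* + B) - (+ Yp ℤ.+ + suc j ℤ.* + A)
      ≡⟨ cong₂ _-_ (+-cast X (suc j) B) (+-cast Yp (suc j) A) ⟨
    + (X + suc j * B) - + (Yp + suc j * A)
      ≡⟨ Equivalence.from (ℤ-diff⇔ℕ {X + suc j * B} {Yp + suc j * A} {νs (suc j)} {νs 0}) balance ⟩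
    + νs (suc j) - + νs 0
      ∎
    where
    open ≡-Reasoning
    B X Yp SY : ℕ
    B  = b ∸ suc j
    X  = armSum f b e (suc j)
    Yp = legPrefix (suc j)
    SY = legSum f a N e (suc j)
    b≡1+j+B : b ≡ suc j + B
    b≡1+j+B = sym (m+[n∸m]≡n (≤-trans 1+j≤e (≤-trans (n≤1+n e) 1+e≤b)))
    regroup : ∀ J B E A X Y → (J ℤ.* (((J ℤ.+ B) - (E ℤ.+ (+ 1 ℤ.+ A)) ℤ.+ (+ 1 ℤ.+ E)) - J) ℤ.+ X) - Y
                              ≡ (X ℤ.+ J ℤ.* B) - (Y ℤ.+ J ℤ.* A)
    regroup = ℤ-solve-∀
    balance : X + suc j * B + νs 0 ≡ νs (suc j) + (Yp + suc j * A)
    balance = begin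
      X + suc j * B + νs 0                             ≡⟨ cong (_+_ (X + suc j * B)) ν₀-split ⟩
      X + suc j * B + (A * (suc j + B) + (Yp + SY))    ≡⟨ rearrange j B A X Yp SY ⟩
      j * B + X + suc A * B + SY + (Yp + suc j * A)    ≡⟨ cong (_+ (Yp + suc j * A)) (ν-suc-formula j (<⇒≤ 1+j≤e)) ⟨
      νs (suc j) + (Yp + suc j * A)                    ∎
      where
      ν₀-split : νs 0 ≡ A * (suc j + B) + (Yp + SY)
      ν₀-split = trans ν₀-formula (cong₂ (λ β y → A * β + y) b≡1+j+B (legSum-split (suc j) 1+j≤e))
      rearrange : ∀ j B A X Yp SY → X + suc j * B + (A * (suc j + B) + (Yp + SY)) ≡ j * B + X + suc A * B + SY + (Yp + suc j * A)
      rearrange = solve-∀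

  Xsum Ysum : ℕ
  Xsum = ∑[ i < e ] cX f b (suc i)
  Ysum = legPrefix e

  ν-last-formula : νs (suc e) ≡ e * (b ∸ suc e) + Xsum + suc A * (b ∸ suc e) + 0
  ν-last-formula = trans (ν-suc-formula e ≤-refl) (cong₂ (λ x y → e * (b ∸ suc e) + x + suc A * (b ∸ suc e) + y) armSum-last legSum-last)
    where
    armSum-last : armSum f b e (suc e) ≡ Xsum
    armSum-last = trans (∑<-cong e (λ i i<e → cong (cX f b) (+-∸-assoc 1 i<e))) (∑<-reverse e (λ i → cX f b (suc i)))
    legSum-last : legSum f a N e (suc e) ≡ 0
    legSum-last = ∑<-zero e (λ i i<e → cong (_* cY f a N (suc i)) (𝟙-≤ᵇ-0 (<-trans i<e (n<1+n e))))

  legSum-all : legSum f a N e 0 ≡ Ysum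
  legSum-all = ∑<-cong e (λ i _ → +-identityʳ _)

  W≡νs-difference : (+ Ysum - + Xsum) - (+ b - + a) ℤ.* + suc e ≡ + νs 0 - + νs (suc e)
  W≡νs-difference = begin
    (+ Ysum - + Xsum) - (+ b - + a) ℤ.* + suc e
      ≡⟨ cong₂ (λ β α → (+ Ysum - + Xsum) - (β - α) ℤ.* + suc e) (+-split (suc e) B b≡1+e+B) (+-split e (suc A) a≡e+1+A) ⟩
    (+ Ysum - + Xsum) - (((+ 1 ℤ.+ + e) ℤ.+ + B) - (+ e ℤ.+ (+ 1 ℤ.+ + A))) ℤ.* (+ 1 ℤ.+ + e)
      ≡⟨ regroup (+ Ysum) (+ Xsum) (+ e) (+ B) (+ A) ⟩
    (+ Ysum ℤ.+ + suc e ℤ.* + A) - (+ Xsum ℤ.+ + suc e ℤ.* + B)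
      ≡⟨ cong₂ _-_ (+-cast Ysum (suc e) A) (+-cast Xsum (suc e) B) ⟨
    + (Ysum + suc e * A) - + (Xsum + suc e * B)
      ≡⟨ Equivalence.from (ℤ-diff⇔ℕ {Ysum + suc e * A} {Xsum + suc e * B} {νs 0} {νs (suc e)}) balance ⟩
    + νs 0 - + νs (suc e)
      ∎
    where
    open ≡-Reasoning
    B : ℕ
    B = b ∸ suc e
    b≡1+e+B : b ≡ suc e + B
    b≡1+e+B = sym (m+[n∸m]≡n 1+e≤b)
    regroup : ∀ Y X E B A → (Y - X) - (((+ 1 ℤ.+ E) ℤ.+ B) - (E ℤ.+ (+ 1 ℤ.+ A))) ℤ.* (+ 1 ℤ.+ E)
                            ≡ (Y ℤ.+ (+ 1 ℤ.+ E) ℤ.* A) - (X ℤ.+ (+ 1 ℤ.+ E) ℤ.* B)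
    regroup = ℤ-solve-∀
    balance : Ysum + suc e * A + νs (suc e) ≡ νs 0 + (Xsum + suc e * B)
    balance = begin
      Ysum + suc e * A + νs (suc e)                                 ≡⟨ cong (_+_ (Ysum + suc e * A)) ν-last-formula ⟩
      Ysum + suc e * A + (e * B + Xsum + suc A * B + 0)             ≡⟨ rearrange e B A Xsum Ysum ⟩
      A * (suc e + B) + Ysum + (Xsum + suc e * B)                   ≡⟨ cong (λ β → A * β + Ysum + (Xsum + suc e * B)) b≡1+e+B ⟨
      A * b + Ysum + (Xsum + suc e * B)                             ≡⟨ cong (_+ (Xsum + suc e * B)) (trans ν₀-formula (cong (_+_ (A * b)) legSum-all)) ⟨
      νs 0 + (Xsum + suc e * B)                                     ∎
      where
      rearrange : ∀ e B A X Y → Y + suc e * A + (e * B + X + suc A * B + 0) ≡ A * (suc e + B) + Y + (X + suc e * B)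
      rearrange = solve-∀

  inequality⇔ν₀≤ν : ∀ j → suc j ≤ e → (+ 0 ℤ.≤ E (+ b - + a) (suc j) ⇔ νs 0 ≤ νs (suc j))
  inequality⇔ν₀≤ν j 1+j≤e = mk⇔
    (λ 0≤E → ℤ.drop‿+≤+ (ℤ.0≤i-j⇒j≤i (subst (+ 0 ℤ.≤_) (E≡νs-difference j 1+j≤e) 0≤E)))
    (λ ν₀≤ν → subst (+ 0 ℤ.≤_) (sym (E≡νs-difference j 1+j≤e)) (ℤ.i≤j⇒0≤j-i (ℤ.+≤+ ν₀≤ν)))

  equation⇔νlast≡ν₀ : (sumℤ (toList yv) - sumℤ (toList xv) ≡ (+ b - + a) ℤ.* + suc e) ⇔ (νs (suc e) ≡ νs 0)
  equation⇔νlast≡ν₀ = mk⇔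
    (λ balanced → sym (ℤ.+-injective (ℤ.i-j≡0⇒i≡j _ _ (trans (sym W≡νs-difference) (ℤ.i≡j⇒i-j≡0 (trans (sym sums) balanced))))))
    (λ νL≡ν₀ → trans sums (ℤ.i-j≡0⇒i≡j _ _ (trans W≡νs-difference (ℤ.i≡j⇒i-j≡0 (cong +_ (sym νL≡ν₀))))))
    where
    sums : sumℤ (toList yv) - sumℤ (toList xv) ≡ + Ysum - + Xsum
    sums = cong₂ _-_ (sumℤ-toList yv _ yv≡cY) (sumℤ-toList xv _ xv≡cX)


count-one-row : ∀ (p : Cell → Bool) D k → (∀ x y → x ≢ suc k → p (x , y) ≡ false) →
                count p (cells D) ≡ countRow p (suc k) (row D (suc k))
count-one-row p D k off-row≡false = begin
  count p (cells D)                             ≡⟨ count-cellsFrom p 1 D n (m≤m+n _ _) ⟩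
  ∑[ r < n ] countRow p (suc r) (nthRow D r)    ≡⟨ ∑<-single n k _ (m≤n+m _ _) other-rows ⟩
  countRow p (suc k) (nthRow D k)               ∎
  where
  open ≡-Reasoning
  n : ℕ
  n = length D + suc k
  other-rows : ∀ r → r < n → r ≢ k → countRow p (suc r) (nthRow D r) ≡ 0
  other-rows r _ r≢k = ∑<-zero (nthRow D r) (λ m _ → cong 𝟙 (off-row≡false (suc r) (suc m) (r≢k ∘ suc-injective)))

countRow-one-column : ∀ (p : Cell → Bool) x l k → (∀ y → y ≢ suc k → p (x , y) ≡ false) →
                      countRow p x l ≡ 𝟙 (suc k ≤ᵇ l) * 𝟙 (p (x , suc k))
countRow-one-column p x l k off-column≡false with k <? l
... | yes k<l = begin
  countRow p x l                    ≡⟨ ∑<-single l k _ k<l (λ m _ m≢k → cong 𝟙 (off-column≡false (suc m) (m≢k ∘ suc-injective))) ⟩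
  𝟙 (p (x , suc k))                 ≡⟨ *-identityˡ _ ⟨
  1 * 𝟙 (p (x , suc k))             ≡⟨ cong (_* 𝟙 (p (x , suc k))) (𝟙-≤ᵇ-1 k<l) ⟨
  𝟙 (suc k ≤ᵇ l) * 𝟙 (p (x , suc k)) ∎
  where open ≡-Reasoning
... | no  k≮l = trans (∑<-zero l (λ m m<l → cong 𝟙 (off-column≡false (suc m) (k≮l ∘ (λ m≡k → subst (_< l) (suc-injective m≡k) m<l)))))
                      (sym (cong (_* 𝟙 (p (x , suc k))) (𝟙-≤ᵇ-0 (s≤s (≮⇒≥ k≮l)))))

cX-count : ∀ e D b k → k < e → cnt (suc k) (Xset (suc (suc e)) D b) ≡ cX (row D) b (suc k)
cX-count e D b k k<e = begin
  cnt (suc k) (Xset (suc (suc e)) D b)          ≡⟨ count-map _ swap (filterᵇ inArm (cells D)) ⟩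
  count _ (filterᵇ inArm (cells D))             ≡⟨ count-filter _ inArm (cells D) ⟩
  count p (cells D)                             ≡⟨ count-one-row p D k off-row ⟩
  countRow p (suc k) (row D (suc k))            ≡⟨ ∑<-cong (row D (suc k)) (λ m _ → cong 𝟙 (on-row m)) ⟩
  ∑[ m < row D (suc k) ] 𝟙 (b ≤ᵇ m)              ≡⟨ ∑<-count-≥ (row D (suc k)) b ⟩
  row D (suc k) ∸ b                             ∎
  where
  open ≡-Reasoning
  inArm : Cell → Bool
  inArm c = (1 ≤ᵇ proj₁ c) ∧ (proj₁ c ≤ᵇ e) ∧ (suc b ≤ᵇ proj₂ c)
  p : Cell → Bool
  p c = inArm c ∧ (proj₂ (swap c) ≡ᵇ suc k)
  off-row : ∀ x y → x ≢ suc k → p (x , y) ≡ false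
  off-row x y x≢1+k rewrite ≡ᵇ-false x≢1+k = ∧-zeroʳ _
  on-row : ∀ m → p (suc k , suc m) ≡ (b ≤ᵇ m)
  on-row m rewrite ≤ᵇ-true k<e | ≡ᵇ-true (suc k) = trans (∧-identityʳ _) (suc≤ᵇsuc b m)

cY-count : ∀ e D a n k → length D ≤ n → a ≤ n → k < e → cnt (suc k) (Yset (suc (suc e)) D a) ≡ cY (row D) a n (suc k)
cY-count e D a n k len≤n a≤n k<e = begin
  cnt (suc k) (Yset (suc (suc e)) D a)
    ≡⟨ count-filter _ inLeg (cells D) ⟩
  count p (cells D)
    ≡⟨ count-cellsFrom p 1 D n len≤n ⟩
  ∑[ r < n ] countRow p (suc r) (nthRow D r)
    ≡⟨ ∑<-cong n (λ r _ → trans (countRow-one-column p (suc r) (nthRow D r) k (off-column r))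
                                (cong (𝟙 (suc k ≤ᵇ nthRow D r) *_) (on-column r))) ⟩
  ∑[ r < n ] (𝟙 (suc k ≤ᵇ nthRow D r) * 𝟙 (a ≤ᵇ r))
    ≡⟨ cong (λ m → ∑< m w) (m+[n∸m]≡n a≤n) ⟨
  ∑[ r < a + (n ∸ a) ] (𝟙 (suc k ≤ᵇ nthRow D r) * 𝟙 (a ≤ᵇ r))
    ≡⟨ ∑<-+ a (n ∸ a) w ⟩
  ∑[ r < a ] (𝟙 (suc k ≤ᵇ nthRow D r) * 𝟙 (a ≤ᵇ r)) + ∑[ r < n ∸ a ] (𝟙 (suc k ≤ᵇ nthRow D (a + r)) * 𝟙 (a ≤ᵇ a + r))
    ≡⟨ cong₂ _+_ (∑<-zero a (λ r r<a → trans (cong (𝟙 (suc k ≤ᵇ nthRow D r) *_) (𝟙-≤ᵇ-0 r<a))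
                                             (*-zeroʳ (𝟙 (suc k ≤ᵇ nthRow D r)))))
                 (∑<-cong (n ∸ a) (λ r _ → leg-row r)) ⟩
  0 + cY (row D) a n (suc k)
    ∎
  where
  open ≡-Reasoning
  w : ℕ → ℕ
  w r = 𝟙 (suc k ≤ᵇ nthRow D r) * 𝟙 (a ≤ᵇ r)
  leg-row : ∀ r → w (a + r) ≡ 𝟙 (suc k ≤ᵇ row D (a + suc r))
  leg-row r = begin
    𝟙 (suc k ≤ᵇ nthRow D (a + r)) * 𝟙 (a ≤ᵇ a + r)
                                                      ≡⟨ cong (𝟙 (suc k ≤ᵇ nthRow D (a + r)) *_) (𝟙-≤ᵇ-1 (m≤m+n a r)) ⟩
    𝟙 (suc k ≤ᵇ nthRow D (a + r)) * 1                 ≡⟨ *-identityʳ _ ⟩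
    𝟙 (suc k ≤ᵇ row D (suc (a + r)))                  ≡⟨ cong (λ x → 𝟙 (suc k ≤ᵇ row D x)) (+-suc a r) ⟨
    𝟙 (suc k ≤ᵇ row D (a + suc r))                    ∎
  inLeg : Cell → Bool
  inLeg c = (suc a ≤ᵇ proj₁ c) ∧ (1 ≤ᵇ proj₂ c) ∧ (proj₂ c ≤ᵇ e)
  p : Cell → Bool
  p c = inLeg c ∧ (proj₂ c ≡ᵇ suc k)
  off-column : ∀ r y → y ≢ suc k → p (suc r , y) ≡ false
  off-column r y y≢1+k rewrite ≡ᵇ-false y≢1+k = ∧-zeroʳ _
  on-column : ∀ r → 𝟙 (p (suc r , suc k)) ≡ 𝟙 (a ≤ᵇ r)
  on-column r rewrite ≤ᵇ-true k<e | ≡ᵇ-true (suc k) = cong 𝟙 (trans (∧-identityʳ _) (trans (∧-identityʳ _) (suc≤ᵇsuc a r)))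

Ψ-x : ∀ e D a b i → i < e → at (proj₁ (Ψ (suc (suc e)) D a b)) (suc i) ≡ + cX (row D) b (suc i)
Ψ-x e D a b i i<e = trans (at-tabulate e (λ i → + cnt (suc i) (Xset (suc (suc e)) D b)) i i<e) (cong +_ (cX-count e D b i i<e))

Ψ-y : ∀ e D a b n i → length D ≤ n → a ≤ n → i < e → at (proj₁ (proj₂ (Ψ (suc (suc e)) D a b))) (suc i) ≡ + cY (row D) a n (suc i)
Ψ-y e D a b n i len≤n a≤n i<e =
  trans (at-tabulate e (λ i → + cnt (suc i) (Yset (suc (suc e)) D a)) i i<e) (cong +_ (cY-count e D a n i len≤n a≤n i<e))


-- Irreducible diagrams of standard shape

module IrreducibleStandard {e a b : ℕ} {D : Diagram} (fer : IsFerrers D) (irr : Irreducible (suc (suc e)) D)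
                            (sh : StandardShape e a b (row D) (length D)) where
  open StandardShape sh

  private
    d L νm : ℕ
    d = suc (suc e)
    L = length D
    νm = νmin d D

  kink-not-minimal : ∀ k → suc k ≤ e → row D (e ∸ k) ≡ row D (suc (e ∸ k)) →
                     (∀ x → a < x → row D x ≤ k ⊎ suc (suc k) ≤ row D x) → ν d (suc k) D ≢ νm
  kink-not-minimal k 1+k≤e equal leg-avoids νk+1≡νm = m+1+n≰m (νm + νm) (begin
    νm + νm + 2                                        ≤⟨ +-monoˡ-≤ 2 (+-mono-≤ (νmin-≤ d D k k<d) (νmin-≤ d D (suc (suc k)) k+2<d)) ⟩
    ν d k D + ν d (suc (suc k)) D + 2                  ≡⟨ cong₂ (λ x y → x + y + 2) ν-low ν-high ⟩
    νᶠ (suc (suc s)) k (row D) L + νᶠ s (suc (suc k)) (row D) L + 2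
                                                       ≡⟨ νᶠ-concave L (row D) s k 1+s<L equal′ long rows-avoid ⟩
    νᶠ (suc s) (suc k) (row D) L + νᶠ (suc s) (suc k) (row D) L
                                                       ≡⟨ cong₂ _+_ ν-middle ν-middle ⟨
    ν d (suc k) D + ν d (suc k) D                      ≡⟨ cong₂ _+_ νk+1≡νm νk+1≡νm ⟩
    νm + νm                                            ∎)
    where
    open ≤-Reasoning
    s : ℕ
    s = e ∸ suc k
    k<d : k < d
    k<d = <-trans (n<1+n k) (≤-trans (s≤s 1+k≤e) (n≤1+n (suc e)))
    k+2<d : suc (suc k) < d
    k+2<d = s≤s (s≤s 1+k≤e)
    e∸k≡1+s : e ∸ k ≡ suc s
    e∸k≡1+s = +-∸-assoc 1 1+k≤e
    1+e∸k≡2+s : suc e ∸ k ≡ suc (suc s)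
    1+e∸k≡2+s = trans (+-∸-assoc 1 (<⇒≤ 1+k≤e)) (cong suc e∸k≡1+s)
    ν-low : ν d k D ≡ νᶠ (suc (suc s)) k (row D) L
    ν-low = trans (ν≡νᶠ d k D L ≤-refl) (cong (λ t → νᶠ t k (row D) L) 1+e∸k≡2+s)
    ν-high : ν d (suc (suc k)) D ≡ νᶠ s (suc (suc k)) (row D) L
    ν-high = ν≡νᶠ d (suc (suc k)) D L ≤-refl
    ν-middle : ν d (suc k) D ≡ νᶠ (suc s) (suc k) (row D) L
    ν-middle = trans (ν≡νᶠ d (suc k) D L ≤-refl) (cong (λ t → νᶠ t (suc k) (row D) L) e∸k≡1+s)
    1+s≤a : suc s ≤ a
    1+s≤a = subst (_≤ a) e∸k≡1+s (≤-trans (m∸n≤m e k) e≤a)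
    1+s<L : suc s < L
    1+s<L = <-≤-trans (subst (_< a) e∸k≡1+s (≤-<-trans (m∸n≤m e k) (<-trans (n<1+n e) 2+e≤a))) a≤N
    equal′ : row D (suc s) ≡ row D (suc (suc s))
    equal′ = subst (λ t → row D t ≡ row D (suc t)) e∸k≡1+s equal
    2+k≤b : suc (suc k) ≤ b
    2+k≤b = ≤-trans (s≤s 1+k≤e) 1+e≤b
    long : suc (suc k) ≤ row D (suc s)
    long = ≤-trans 2+k≤b (b≤f (suc s) (s≤s z≤n) 1+s≤a)
    rows-avoid : ∀ i → suc (suc s) ≤ i → row D (suc i) ≤ k ⊎ suc (suc k) ≤ row D (suc i)
    rows-avoid i _ with suc i ≤? a
    ... | yes 1+i≤a = inj₂ (≤-trans 2+k≤b (b≤f (suc i) (s≤s z≤n) 1+i≤a))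
    ... | no  1+i≰a = leg-avoids (suc i) (≰⇒> 1+i≰a)

  private
    K≤a : ∀ k → suc (e ∸ k) ≤ a
    K≤a k = ≤-trans (s≤s (m∸n≤m e k)) (<⇒≤ 2+e≤a)

    row-≥b : ∀ k → b ≤ row D (suc (e ∸ k))
    row-≥b k = b≤f (suc (e ∸ k)) (s≤s z≤n) (K≤a k)

    equal-or-steps : ∀ k → suc k ≤ e → ¬ row D (suc (e ∸ k)) < row D (e ∸ k) → row D (e ∸ k) ≡ row D (suc (e ∸ k))
    equal-or-steps k 1+k≤e no-step = ≤-antisym (≮⇒≥ no-step) (row-antitone D fer (m<n⇒0<n∸m 1+k≤e) (n≤1+n _))

    minimal? : ∀ j → Dec (ν d j D ≡ νm)
    minimal? j = ν d j D ≟ νm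

    some-minimiser : ∃ λ j → j < d × ν d j D ≡ νm
    some-minimiser = let j , j<d , νm≡νj = νmin-attained d D z<s in j , j<d , sym νm≡νj

    minimiser-below-e+1 : ν d (suc e) D ≢ νm → ∃ λ j → j < suc e × ν d j D ≡ νm
    minimiser-below-e+1 νL≢νm with some-minimiser
    ... | j , j<d , νj≡νm = j , ≤∧≢⇒< (s≤s⁻¹ j<d) (λ { refl → νL≢νm νj≡νm }) , νj≡νm

  -- For a least minimiser k + 1 > 0, the cell appended to row e − k + 1 lies in every minimal
  -- quadrant and the corner of the last row in none.
  first-minimiser-is-0 : ∀ k → suc k < d → ν d (suc k) D ≡ νm → (∀ j → j < suc k → ¬ ν d j D ≡ νm) → ⊥
  first-minimiser-is-0 k 1+k<d minimal below = kink-not-minimal k 1+k≤e equal leg-avoids minimal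
    where
    K : ℕ
    K = suc (e ∸ k)
    k≤e : k ≤ e
    k≤e = s≤s⁻¹ (s≤s⁻¹ 1+k<d)
    minimisers-≥ : ∀ j → j < d → ν d j D ≡ νm → suc k ≤ j
    minimisers-≥ j _ νj≡νm = ≮⇒≥ (λ j<1+k → below j j<1+k νj≡νm)
    in-every : ∀ j → j < d → ν d j D ≡ νm → inQuadrant d j (K , suc (row D K)) ≡ true
    in-every j j<d νj≡νm = inQuadrant-true d j (subst (d ∸ j ≤_) (+-∸-assoc 1 k≤e) (∸-monoʳ-≤ d (minimisers-≥ j j<d νj≡νm)))
                                           (s≤s (≤-trans (s≤s⁻¹ j<d) (≤-trans 1+e≤b (row-≥b k))))
    addable⇒⊥ : (2 ≤ K → row D K < row D (K ∸ 1)) → ⊥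
    addable⇒⊥ addable = addable-cell-misses-a-minimal-quadrant fer irr z<s K (s≤s z≤n) addable in-every
    1+k≤e : suc k ≤ e
    1+k≤e with suc k ≤? e
    ... | yes 1+k≤e = 1+k≤e
    ... | no  1+k≰e = ⊥-elim (addable⇒⊥ (λ 2≤K → contradiction (subst (1 ≤_) e∸k≡0 (s≤s⁻¹ 2≤K)) λ ()))
      where
      e∸k≡0 : e ∸ k ≡ 0
      e∸k≡0 = m≤n⇒m∸n≡0 (s≤s⁻¹ (≰⇒> 1+k≰e))
    equal : row D (e ∸ k) ≡ row D K
    equal = equal-or-steps k 1+k≤e (λ step → addable⇒⊥ (λ _ → step))
    last-row-long : a < L → suc (suc k) ≤ row D L
    last-row-long a<L with suc (suc k) ≤? row D L
    ... | yes long  = long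
    ... | no  short = ⊥-elim (corner-meets-a-minimal-quadrant fer irr z<s L 1≤L corner in-none)
      where
      1≤L : 1 ≤ L
      1≤L = ≤-trans (s≤s z≤n) a<L
      corner : row D (suc L) < row D L
      corner = subst (_< row D L) (sym (row-beyond D (n<1+n L))) (row-pos D fer 1≤L ≤-refl)
      in-none : ∀ j → j < d → ν d j D ≡ νm → inQuadrant d j (L , row D L) ≡ false
      in-none j j<d νj≡νm = inQuadrant-false-column d j (≤-trans (s≤s⁻¹ (≰⇒> short)) (minimisers-≥ j j<d νj≡νm))
    leg-avoids : ∀ x → a < x → row D x ≤ k ⊎ suc (suc k) ≤ row D x
    leg-avoids x a<x with x ≤? L
    ... | yes x≤L = inj₂ (≤-trans (last-row-long (<-≤-trans a<x x≤L)) (row-antitone D fer (≤-trans (s≤s z≤n) a<x) x≤L))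
    ... | no  x≰L = inj₁ (subst (_≤ k) (sym (row-beyond D (≰⇒> x≰L))) z≤n)

  ν₀-minimal : ν d 0 D ≡ νm
  ν₀-minimal with least-below minimal? d some-minimiser
  ... | zero  , _     , ν₀≡νm , _     = ν₀≡νm
  ... | suc k , 1+k<d , minimal , below = ⊥-elim (first-minimiser-is-0 k 1+k<d minimal below)

  -- For a greatest minimiser m < e + 1, the cell appended to row a + 1 lies in every minimal
  -- quadrant and, if m = k + 1, the corner of row e − k in none.
  last-minimiser-is-e+1 : ∀ m → m < suc e → ν d m D ≡ νm → (∀ j → m < j → j < suc e → ¬ ν d j D ≡ νm) →
                          ν d (suc e) D ≢ νm → ⊥
  last-minimiser-is-e+1 m m<1+e minimal above νL≢νm = by-cases m refl
    where
    minimisers-≤ : ∀ j → j < d → ν d j D ≡ νm → j ≤ m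
    minimisers-≤ j j<d νj≡νm with j ≤? m | j ≟ suc e
    ... | yes j≤m | _        = j≤m
    ... | no  _   | yes refl = contradiction νj≡νm νL≢νm
    ... | no  j≰m | no  j≢1+e = contradiction νj≡νm (above j (≰⇒> j≰m) (≤∧≢⇒< (s≤s⁻¹ j<d) j≢1+e))
    leg-short : row D (suc a) < m
    leg-short with m ≤? row D (suc a)
    ... | no  m≰leg = ≰⇒> m≰leg
    ... | yes m≤leg = ⊥-elim (addable-cell-misses-a-minimal-quadrant fer irr z<s (suc a) (s≤s z≤n) (λ _ → step) in-every)
      where
      step : row D (suc a) < row D a
      step = <-≤-trans (s≤s (leg (suc a) (n<1+n a))) (≤-trans 1+e≤b (b≤f a (≤-trans (s≤s z≤n) 2+e≤a) ≤-refl))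
      in-every : ∀ j → j < d → ν d j D ≡ νm → inQuadrant d j (suc a , suc (row D (suc a))) ≡ true
      in-every j j<d νj≡νm = inQuadrant-true d j (≤-trans (m∸n≤m d j) (≤-trans 2+e≤a (n≤1+n a)))
                                             (s≤s (≤-trans (minimisers-≤ j j<d νj≡νm) m≤leg))
    by-cases : ∀ m′ → m′ ≡ m → ⊥
    by-cases zero    refl = contradiction leg-short λ ()
    by-cases (suc k) refl = kink-not-minimal k 1+k≤e equal leg-avoids minimal
      where
      1+k≤e : suc k ≤ e
      1+k≤e = s≤s⁻¹ m<1+e
      equal : row D (e ∸ k) ≡ row D (suc (e ∸ k))
      equal = equal-or-steps k 1+k≤e (λ step → corner-meets-a-minimal-quadrant fer irr z<s (e ∸ k) (m<n⇒0<n∸m 1+k≤e) step in-none)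
        where
        in-none : ∀ j → j < d → ν d j D ≡ νm → inQuadrant d j (e ∸ k , row D (e ∸ k)) ≡ false
        in-none j j<d νj≡νm = inQuadrant-false-row d j {y = row D (e ∸ k)}
          (<-≤-trans (n<1+n (e ∸ k)) (subst (_≤ d ∸ j) (+-∸-assoc 1 (<⇒≤ 1+k≤e)) (∸-monoʳ-≤ d (minimisers-≤ j j<d νj≡νm))))
      leg-avoids : ∀ x → a < x → row D x ≤ k ⊎ suc (suc k) ≤ row D x
      leg-avoids x a<x = inj₁ (s≤s⁻¹ (≤-<-trans (row-antitone D fer (s≤s z≤n) a<x) leg-short))

  ν-last-minimal : ν d (suc e) D ≡ νm
  ν-last-minimal with ν d (suc e) D ≟ νm
  ... | yes νL≡νm = νL≡νm
  ... | no  νL≢νm with greatest-below minimal? (suc e) (minimiser-below-e+1 νL≢νm)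
  ...   | m , m<1+e , minimal , above = ⊥-elim (last-minimiser-is-e+1 m m<1+e minimal above νL≢νm)

module _ {e a b N : ℕ} {D : Diagram} (sh : StandardShape e a b (row D) N)
         (ν₀≡νm : ν (suc (suc e)) 0 D ≡ νmin (suc (suc e)) D) (νL≡νm : ν (suc (suc e)) (suc e) D ≡ νmin (suc (suc e)) D) where
  open StandardShape sh

  private
    d νm : ℕ
    d = suc (suc e)
    νm = νmin d D

    removal-keeps-νmin⇒⊥ : ∀ {D′ k} → LastCellRemoved D k D′ → νmin d D′ ≡ νm →
                           ∀ j → j < d → ν d j D ≡ νm → inQuadrant d j (k , row D k) ≡ true → ⊥
    removal-keeps-νmin⇒⊥ {D′} {k} rem νm′≡νm j j<d νj≡νm inside = 1+n≰n (begin
      suc (ν d j D′)                                ≡⟨ +-comm 1 _ ⟩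
      ν d j D′ + 1                                  ≡⟨ cong (λ c → ν d j D′ + 𝟙 c) inside ⟨
      ν d j D′ + 𝟙 (inQuadrant d j (k , row D k))   ≡⟨ ν-lastCellRemoved d D D′ k rem j ⟨
      ν d j D                                       ≡⟨ νj≡νm ⟩
      νm                                            ≡⟨ νm′≡νm ⟨
      νmin d D′                                     ≤⟨ νmin-≤ d D′ j j<d ⟩
      ν d j D′                                      ∎)
      where open ≤-Reasoning

    addition-keeps-νmin : ∀ {D′ k} → LastCellRemoved D′ k D →
                          ∀ j → j < d → ν d j D ≡ νm → inQuadrant d j (k , row D′ k) ≡ false → νmin d D′ ≡ νm
    addition-keeps-νmin {D′} {k} rem j j<d νj≡νm outside = ≤-antisym upper lower
      where
      ν′ : ∀ i → ν d i D′ ≡ ν d i D + 𝟙 (inQuadrant d i (k , row D′ k))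
      ν′ = ν-lastCellRemoved d D′ D k rem
      upper : νmin d D′ ≤ νm
      upper = ≤-trans (νmin-≤ d D′ j j<d)
                      (≤-reflexive (trans (ν′ j) (trans (cong (λ c → ν d j D + 𝟙 c) outside) (trans (+-identityʳ _) νj≡νm))))
      lower : νm ≤ νmin d D′
      lower = νmin-greatest d D′ νm z<s (λ i i<d → ≤-trans (νmin-≤ d D i i<d) (≤-trans (m≤m+n _ _) (≤-reflexive (sym (ν′ i)))))

    removal-case : ∀ {D′ k} → LastCellRemoved D k D′ → νmin d D′ ≡ νm → ⊥
    removal-case {D′} {k} rem νm′≡νm with d ≤? k
    ... | yes d≤k = removal-keeps-νmin⇒⊥ rem νm′≡νm 0 z<s ν₀≡νm
                      (inQuadrant-true d 0 d≤k (subst (1 ≤_) (sym row-k) (s≤s z≤n)))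
      where open LastCellRemoved rem
    ... | no  d≰k = removal-keeps-νmin⇒⊥ rem νm′≡νm (suc e) ≤-refl νL≡νm
                      (inQuadrant-true d (suc e) (subst (_≤ k) (sym (m+n∸n≡m 1 e)) 1≤k) (≤-trans 2+e≤b (b≤f k 1≤k k≤a)))
      where
      open LastCellRemoved rem
      k≤a : k ≤ a
      k≤a = ≤-trans (s≤s⁻¹ (≰⇒> d≰k)) (<⇒≤ 2+e≤a)

    addition-case : ∀ {D′ k} → IsFerrers D′ → LastCellRemoved D′ k D → νmin d D′ ≡ νm
    addition-case {D′} {k} fer′ rem with d ≤? k
    ... | no  d≰k = addition-keeps-νmin rem 0 z<s ν₀≡νm (inQuadrant-false-row d 0 {y = row D′ k} (≰⇒> d≰k))
    ... | yes d≤k = addition-keeps-νmin rem (suc e) ≤-refl νL≡νm (inQuadrant-false-column d (suc e) row′≤1+e)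
      where
      open LastCellRemoved rem
      row′≤1+e : row D′ k ≤ suc e
      row′≤1+e with k ≤? a
      ... | no  k≰a = subst (_≤ suc e) (sym row-k) (s≤s (leg k (≰⇒> k≰a)))
      ... | yes k≤a = contradiction overhang 1+n≰n
        where
        k′ : ℕ
        k′ = pred k
        1+e≤k′ : suc e ≤ k′
        1+e≤k′ = pred-mono-≤ d≤k
        k′<k : k′ < k
        k′<k = subst (k′ <_) (suc-pred k {{>-nonZero (≤-trans (s≤s z≤n) d≤k)}}) ≤-refl
        overhang : suc b ≤ b
        overhang = begin
          suc b         ≡⟨ cong suc (body k (≤-trans (n≤1+n _) d≤k) k≤a) ⟨
          suc (row D k) ≡⟨ row-k ⟨
          row D′ k      ≤⟨ row-antitone D′ fer′ (≤-trans (s≤s z≤n) 1+e≤k′) (<⇒≤ k′<k) ⟩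
          row D′ k′     ≡⟨ row-≢k k′ (<⇒≢ k′<k) (≤-trans (s≤s z≤n) 1+e≤k′) ⟨
          row D k′      ≡⟨ body k′ 1+e≤k′ (≤-trans (<⇒≤ k′<k) k≤a) ⟩
          b             ∎
          where open ≤-Reasoning

  -- A removed corner lies in the quadrant of ν_0 or of ν_{d−1}; an added cell misses one of them.
  extremes-minimal⇒irreducible : Irreducible d D
  extremes-minimal⇒irreducible D′ fer′ (inj₁ ((k , c) , P∈D , isRem , νm′≡νm)) =
    removal-case (proj₂ (removal⇒lastCellRemoved D D′ k c isRem P∈D)) νm′≡νm
  extremes-minimal⇒irreducible D′ fer′ (inj₂ ((k , c) , P∈D′ , isRem , νm≢νm′)) =
    νm≢νm′ (sym (addition-case fer′ (proj₂ (removal⇒lastCellRemoved D′ D k c isRem P∈D′))))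


-- Reconstructing a diagram from its coordinates

module _ {e a b f N} (sh : StandardShape e a b f N) where
  open StandardShape sh

  leg-row-conjugate : ∀ r → f (a + suc r) ≡ ∑[ i < e ] 𝟙 (suc r ≤ᵇ cY f a N (suc i))
  leg-row-conjugate r = begin
    f (a + suc r)                             ≡⟨ ∑<-count-< e _ (leg _ (m<m+n a z<s)) ⟨
    ∑[ i < e ] 𝟙 (suc i ≤ᵇ f (a + suc r))     ≡⟨ ∑<-cong e (λ i _ → cong 𝟙 (conjugate i)) ⟨
    ∑[ i < e ] 𝟙 (suc r ≤ᵇ cY f a N (suc i))  ∎
    where
    open ≡-Reasoning
    conjugate : ∀ i → (suc r ≤ᵇ cY f a N (suc i)) ≡ (suc i ≤ᵇ f (a + suc r))
    conjugate i with r <? N ∸ a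
    ... | yes r<N∸a = count-downClosed (N ∸ a) (λ r′ → suc i ≤ᵇ f (a + suc r′)) shorter r r<N∸a
      where
      shorter : DownClosed (N ∸ a) (λ r′ → suc i ≤ᵇ f (a + suc r′))
      shorter k _ long = ≤ᵇ-true (≤-trans (≤ᵇ-true⁻¹ long) (subst (λ x → f x ≤ f (a + suc k)) (sym (+-suc a (suc k)))
                                                                  (antitone (a + suc k) (≤-trans (s≤s z≤n) (m≤n+m _ a)))))
    ... | no  r≮N∸a = trans (≤ᵇ-false (s≤s (≤-trans (∑<-𝟙-≤ (N ∸ a) _) (≮⇒≥ r≮N∸a))))
                            (sym (≤ᵇ-false (subst (_< suc i) (sym (beyond (a + suc r) N<a+1+r)) z<s)))
      where
      N<a+1+r : N < a + suc r
      N<a+1+r = subst (_< a + suc r) (m+[n∸m]≡n a≤N) (+-monoʳ-< a (s≤s (≮⇒≥ r≮N∸a)))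

shape-determined : ∀ {e a b f₁ f₂ N₁ N₂} → StandardShape e a b f₁ N₁ → StandardShape e a b f₂ N₂ →
                   (∀ i → i < e → cX f₁ b (suc i) ≡ cX f₂ b (suc i)) →
                   (∀ i → i < e → cY f₁ a N₁ (suc i) ≡ cY f₂ a N₂ (suc i)) →
                   ∀ x → 1 ≤ x → f₁ x ≡ f₂ x
shape-determined {e} {a} {b} {f₁} {f₂} sh₁ sh₂ same-cX same-cY x 1≤x with x ≤? e | x ≤? a
... | yes x≤e | _ = begin
  f₁ x              ≡⟨ m+[n∸m]≡n (S₁.arm x 1≤x x≤e) ⟨
  b + cX f₁ b x     ≡⟨ cong (_+_ b) (same-cX′ x 1≤x x≤e) ⟩
  b + cX f₂ b x     ≡⟨ m+[n∸m]≡n (S₂.arm x 1≤x x≤e) ⟩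
  f₂ x              ∎
  where
  open ≡-Reasoning
  module S₁ = StandardShape sh₁
  module S₂ = StandardShape sh₂
  same-cX′ : ∀ x → 1 ≤ x → x ≤ e → cX f₁ b x ≡ cX f₂ b x
  same-cX′ (suc i) _ i<e = same-cX i i<e
... | no x≰e | yes x≤a = trans (StandardShape.body sh₁ x (≰⇒> x≰e) x≤a) (sym (StandardShape.body sh₂ x (≰⇒> x≰e) x≤a))
... | no _   | no x≰a  = begin
  f₁ x                                        ≡⟨ cong f₁ x≡a+1+r ⟩
  f₁ (a + suc r)                              ≡⟨ leg-row-conjugate sh₁ r ⟩
  ∑[ i < e ] 𝟙 (suc r ≤ᵇ cY f₁ a _ (suc i))    ≡⟨ ∑<-cong e (λ i i<e → cong (λ c → 𝟙 (suc r ≤ᵇ c)) (same-cY i i<e)) ⟩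
  ∑[ i < e ] 𝟙 (suc r ≤ᵇ cY f₂ a _ (suc i))    ≡⟨ leg-row-conjugate sh₂ r ⟨
  f₂ (a + suc r)                              ≡⟨ cong f₂ x≡a+1+r ⟨
  f₂ x                                        ∎
  where
  open ≡-Reasoning
  r : ℕ
  r = x ∸ suc a
  x≡a+1+r : x ≡ a + suc r
  x≡a+1+r = trans (sym (m+[n∸m]≡n (≰⇒> x≰a))) (sym (+-suc a r))

-- The diagram whose arm rows have length b + X i, whose body rows have length b and whose leg
-- is conjugate to Y.
module FromCounts {e a b : ℕ} (X Y : ℕ → ℕ) (2+e≤a : suc (suc e) ≤ a) (2+e≤b : suc (suc e) ≤ b)
    (X-antitone : ∀ i → suc i < e → X (suc (suc i)) ≤ X (suc i))
    (Y-antitone : ∀ i → suc i < e → Y (suc (suc i)) ≤ Y (suc i)) where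

  legLength : ℕ → ℕ
  legLength r = ∑[ i < e ] 𝟙 (r ≤ᵇ Y (suc i))

  rows : ℕ → ℕ
  rows x with x ≤? e | x ≤? a
  ... | yes _ | _     = b + X x
  ... | no  _ | yes _ = b
  ... | no  _ | no  _ = legLength (x ∸ a)

  rows-arm : ∀ x → x ≤ e → rows x ≡ b + X x
  rows-arm x x≤e with x ≤? e
  ... | yes _   = refl
  ... | no  x≰e = contradiction x≤e x≰e

  rows-body : ∀ x → e < x → x ≤ a → rows x ≡ b
  rows-body x e<x x≤a with x ≤? e | x ≤? a
  ... | yes x≤e | _       = contradiction x≤e (<⇒≱ e<x)
  ... | no  _   | yes _   = refl
  ... | no  _   | no  x≰a = contradiction x≤a x≰a

  rows-leg : ∀ x → a < x → rows x ≡ legLength (x ∸ a)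
  rows-leg x a<x with x ≤? e | x ≤? a
  ... | yes x≤e | _       = contradiction (≤-trans x≤e (≤-trans (n≤1+n e) (<⇒≤ 2+e≤a))) (<⇒≱ a<x)
  ... | no  _   | yes x≤a = contradiction x≤a (<⇒≱ a<x)
  ... | no  _   | no  _   = refl

  legLength≤e : ∀ r → legLength r ≤ e
  legLength≤e r = ∑<-𝟙-≤ e (λ i → r ≤ᵇ Y (suc i))

  Y≤Y₁ : ∀ i → i < e → Y (suc i) ≤ Y 1
  Y≤Y₁ zero    _     = ≤-refl
  Y≤Y₁ (suc i) 1+i<e = ≤-trans (Y-antitone i 1+i<e) (Y≤Y₁ i (<-trans (n<1+n i) 1+i<e))

  legLength-beyond : ∀ r → Y 1 < r → legLength r ≡ 0
  legLength-beyond r Y₁<r = ∑<-zero e (λ i i<e → 𝟙-≤ᵇ-0 (≤-<-trans (Y≤Y₁ i i<e) Y₁<r))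

  legLength-antitone : ∀ r → legLength (suc r) ≤ legLength r
  legLength-antitone r = ∑<-mono-≤ e (λ i _ → 𝟙-suc-≤ᵇ r (Y (suc i)))

  N : ℕ
  N = a + Y 1

  rows-antitone : Antitone (rows ∘ suc)
  rows-antitone x = by-cases (suc (suc x) ≤? e) (suc x ≤? e) (suc (suc x) ≤? a) (suc x ≤? a)
    where
    by-cases : Dec (suc (suc x) ≤ e) → Dec (suc x ≤ e) → Dec (suc (suc x) ≤ a) → Dec (suc x ≤ a) → rows (suc (suc x)) ≤ rows (suc x)
    by-cases (yes 2+x≤e) _ _ _ =
      subst₂ _≤_ (sym (rows-arm _ 2+x≤e)) (sym (rows-arm _ (<⇒≤ 2+x≤e))) (+-monoʳ-≤ b (X-antitone x 2+x≤e))
    by-cases (no 2+x≰e) (yes 1+x≤e) _ _ =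
      subst₂ _≤_ (sym (rows-body _ (≰⇒> 2+x≰e) (≤-trans (s≤s 1+x≤e) (<⇒≤ 2+e≤a)))) (sym (rows-arm _ 1+x≤e)) (m≤m+n b _)
    by-cases (no 2+x≰e) (no 1+x≰e) (yes 2+x≤a) _ =
      ≤-reflexive (trans (rows-body _ (≰⇒> 2+x≰e) 2+x≤a) (sym (rows-body _ (≰⇒> 1+x≰e) (<⇒≤ 2+x≤a))))
    by-cases (no _) (no 1+x≰e) (no 2+x≰a) (yes 1+x≤a) =
      subst₂ _≤_ (sym (rows-leg _ (≰⇒> 2+x≰a))) (sym (rows-body _ (≰⇒> 1+x≰e) 1+x≤a))
             (≤-trans (legLength≤e (suc (suc x) ∸ a)) (≤-trans (n≤1+n e) (<⇒≤ 2+e≤b)))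
    by-cases (no _) (no _) (no 2+x≰a) (no 1+x≰a) =
      subst₂ _≤_ (sym (rows-leg _ (≰⇒> 2+x≰a))) (sym (rows-leg _ (≰⇒> 1+x≰a)))
             (subst (λ r → legLength r ≤ legLength (suc x ∸ a)) (sym (+-∸-assoc 1 (s≤s⁻¹ (≰⇒> 2+x≰a)))) (legLength-antitone _))

  rows-beyond : ∀ i → N ≤ i → rows (suc i) ≡ 0
  rows-beyond i N≤i = trans (rows-leg (suc i) (s≤s a≤i)) (legLength-beyond (suc i ∸ a) Y₁<1+i-a)
    where
    a≤i : a ≤ i
    a≤i = ≤-trans (m≤m+n a (Y 1)) N≤i
    Y₁<1+i-a : Y 1 < suc i ∸ a
    Y₁<1+i-a = subst (Y 1 <_) (sym (+-∸-assoc 1 a≤i)) (s≤s (subst (_≤ i ∸ a) (m+n∸m≡n a (Y 1)) (∸-monoˡ-≤ a N≤i)))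

  D : Diagram
  D = fromRows (rows ∘ suc) N

  ferrers : IsFerrers D
  ferrers = fromRows-ferrers N (rows ∘ suc) rows-antitone

  row-D : ∀ x → 1 ≤ x → row D x ≡ rows x
  row-D (suc i) _ = nthRow-fromRows N (rows ∘ suc) rows-antitone rows-beyond i

  length-D : length D ≤ N
  length-D = length-fromRows N (rows ∘ suc)

  shape : StandardShape e a b (row D) N
  shape = record
    { 2+e≤a = 2+e≤a ; 2+e≤b = 2+e≤b ; a≤N = m≤m+n a (Y 1)
    ; antitone = λ { (suc i) _ → subst₂ _≤_ (sym (row-D (suc (suc i)) (s≤s z≤n))) (sym (row-D (suc i) (s≤s z≤n))) (rows-antitone i) }
    ; arm      = λ x 1≤x x≤e → subst (b ≤_) (sym (trans (row-D x 1≤x) (rows-arm x x≤e))) (m≤m+n b _)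
    ; body     = λ x 1+e≤x x≤a → trans (row-D x (≤-trans (s≤s z≤n) 1+e≤x)) (rows-body x 1+e≤x x≤a)
    ; leg      = λ x a<x → subst (_≤ e) (sym (trans (row-D x (≤-trans (s≤s z≤n) a<x)) (rows-leg x a<x))) (legLength≤e (x ∸ a))
    ; beyond   = λ { (suc i) N<x → trans (row-D (suc i) (s≤s z≤n)) (rows-beyond i (s≤s⁻¹ N<x)) }
    }

  cX-D : ∀ i → i < e → cX (row D) b (suc i) ≡ X (suc i)
  cX-D i i<e = trans (cong (_∸ b) (trans (row-D (suc i) (s≤s z≤n)) (rows-arm (suc i) i<e))) (m+n∸m≡n b _)

  cY-D : ∀ i → i < e → cY (row D) a N (suc i) ≡ Y (suc i)
  cY-D i i<e = begin
    ∑[ r < N ∸ a ] 𝟙 (suc i ≤ᵇ row D (a + suc r))   ≡⟨ cong (λ n → ∑< n legCell) (m+n∸m≡n a (Y 1)) ⟩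
    ∑[ r < Y 1 ] 𝟙 (suc i ≤ᵇ row D (a + suc r))     ≡⟨ ∑<-cong (Y 1) (λ r _ → cong 𝟙 (conjugate r)) ⟩
    ∑[ r < Y 1 ] 𝟙 (suc r ≤ᵇ Y (suc i))             ≡⟨ ∑<-count-< (Y 1) (Y (suc i)) (Y≤Y₁ i i<e) ⟩
    Y (suc i)                                       ∎
    where
    open ≡-Reasoning
    legCell : ℕ → ℕ
    legCell r = 𝟙 (suc i ≤ᵇ row D (a + suc r))
    conjugate : ∀ r → (suc i ≤ᵇ row D (a + suc r)) ≡ (suc r ≤ᵇ Y (suc i))
    conjugate r = begin
      (suc i ≤ᵇ row D (a + suc r))     ≡⟨ cong (suc i ≤ᵇ_) (trans (row-D (a + suc r) (≤-trans (s≤s z≤n) (m<m+n a z<s)))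
                                                                  (rows-leg _ (m<m+n a z<s))) ⟩
      (suc i ≤ᵇ legLength (a + suc r ∸ a)) ≡⟨ cong (λ r′ → suc i ≤ᵇ legLength r′) (m+n∸m≡n a (suc r)) ⟩
      (suc i ≤ᵇ legLength (suc r))     ≡⟨ count-downClosed e (λ i′ → suc r ≤ᵇ Y (suc i′)) longer i i<e ⟩
      (suc r ≤ᵇ Y (suc i))             ∎
      where
      longer : DownClosed e (λ i′ → suc r ≤ᵇ Y (suc i′))
      longer k 1+k<e long = ≤ᵇ-true (≤-trans (≤ᵇ-true⁻¹ long) (Y-antitone k 1+k<e))


module _ {e μ : ℕ} (d≤μ : suc (suc e) ≤ μ) where

  private
    d : ℕ
    d = suc (suc e)

  inIrr⇒shape : ∀ {D a b} → InIrr d μ D a b → StandardShape e a b (row D) (length D)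
  inIrr⇒shape (fer , _ , sf , min≡μ) =
    standardForm⇒shape fer sf (≤-trans d≤μ (proj₁ (⊓≡⇒≤ min≡μ))) (≤-trans d≤μ (proj₂ (⊓≡⇒≤ min≡μ)))

  module Coordinates (D : Diagram) (a b : ℕ) (I : InIrr d μ D a b) where

    sh : StandardShape e a b (row D) (length D)
    sh = inIrr⇒shape I

    open StandardShape sh using (antitone; a≤N)

    xv yv : Vec ℤ e
    xv = proj₁ (Ψ d D a b)
    yv = proj₁ (proj₂ (Ψ d D a b))

    xv≡cX : ∀ i → i < e → at xv (suc i) ≡ + cX (row D) b (suc i)
    xv≡cX = Ψ-x e D a b

    yv≡cY : ∀ i → i < e → at yv (suc i) ≡ + cY (row D) a (length D) (suc i)
    yv≡cY i = Ψ-y e D a b (length D) i ≤-refl a≤N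

    open 𝔓Conditions sh xv yv xv≡cX yv≡cY using (νs; E; inequality⇔ν₀≤ν; equation⇔νlast≡ν₀)
    open IrreducibleStandard (proj₁ I) (proj₁ (proj₂ I)) sh using (ν₀-minimal; ν-last-minimal)

    νs≡ν : ∀ j → νs j ≡ ν d j D
    νs≡ν j = sym (ν≡νᶠ d j D (length D) ≤-refl)

    monotone : ∀ j → 1 ≤ j → j ≤ e ∸ 1 → (at xv (suc j) ℤ.≤ at xv j) × (at yv (suc j) ℤ.≤ at yv j)
    monotone (suc j) _ 1+j≤e-1 =
      subst₂ ℤ._≤_ (sym (xv≡cX (suc j) 2+j≤e)) (sym (xv≡cX j 1+j≤e)) (ℤ.+≤+ (∸-monoˡ-≤ b (antitone (suc j) (s≤s z≤n)))) ,
      subst₂ ℤ._≤_ (sym (yv≡cY (suc j) 2+j≤e)) (sym (yv≡cY j 1+j≤e))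
             (ℤ.+≤+ (∑<-mono-≤ (length D ∸ a) (λ r _ → 𝟙-suc-≤ᵇ (suc j) (row D (a + suc r)))))
      where
      2+j≤e : suc (suc j) ≤ e
      2+j≤e = 1+m≤n∸1⇒2+m≤n 1+j≤e-1
      1+j≤e : suc j ≤ e
      1+j≤e = <⇒≤ 2+j≤e

    nonnegative : ∀ j → 1 ≤ j → j ≤ e → (+ 0 ℤ.≤ at xv j) × (+ 0 ℤ.≤ at yv j)
    nonnegative (suc j) _ 1+j≤e =
      subst (+ 0 ℤ.≤_) (sym (xv≡cX j 1+j≤e)) (ℤ.+≤+ z≤n) , subst (+ 0 ℤ.≤_) (sym (yv≡cY j 1+j≤e)) (ℤ.+≤+ z≤n)

    inequalities : ∀ j → 1 ≤ j → j ≤ e → + 0 ℤ.≤ E (+ b - + a) j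
    inequalities (suc j) _ 1+j≤e = Equivalence.from (inequality⇔ν₀≤ν j 1+j≤e) (subst₂ _≤_ (sym (νs≡ν 0)) (sym (νs≡ν (suc j))) ν₀≤ν)
      where
      ν₀≤ν : ν d 0 D ≤ ν d (suc j) D
      ν₀≤ν = subst (_≤ ν d (suc j) D) (sym ν₀-minimal) (νmin-≤ d D (suc j) (s≤s (≤-trans 1+j≤e (n≤1+n e))))

    equation : sumℤ (toList yv) - sumℤ (toList xv) ≡ (+ b - + a) ℤ.* + suc e
    equation = Equivalence.from equation⇔νlast≡ν₀ (trans (νs≡ν (suc e)) (trans νlast≡ν₀ (sym (νs≡ν 0))))
      where
      νlast≡ν₀ : ν d (suc e) D ≡ ν d 0 D
      νlast≡ν₀ = trans ν-last-minimal (sym ν₀-minimal)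

  Ψ-in-𝔓 : ∀ D a b → InIrr d μ D a b → InP d (Ψ d D a b)
  Ψ-in-𝔓 D a b I = monotone , nonnegative , inequalities , equation
    where open Coordinates D a b I

  Ψ-well-defined : ∀ D a b a′ b′ → InIrr d μ D a b → InIrr d μ D a′ b′ → Ψ d D a b ≡ Ψ d D a′ b′
  Ψ-well-defined D a b a′ b′ (_ , _ , sf , _) (_ , _ , sf′ , _) with standardForm-unique d D sf sf′
  ... | refl , refl = refl

  Ψ-injective : ∀ D₁ D₂ a₁ b₁ a₂ b₂ → InIrr d μ D₁ a₁ b₁ → InIrr d μ D₂ a₂ b₂ →
                Ψ d D₁ a₁ b₁ ≡ Ψ d D₂ a₂ b₂ → D₁ ≡ D₂
  Ψ-injective D₁ D₂ a₁ b₁ a₂ b₂ I₁@(fer₁ , _ , _ , min₁) I₂@(fer₂ , _ , _ , min₂) Ψ≡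
    with minDiff-injective min₁ min₂ (cong (proj₂ ∘ proj₂) Ψ≡)
  ... | refl , refl = ferrers-ext D₁ D₂ fer₁ fer₂ (λ i → shape-determined C₁.sh C₂.sh same-cX same-cY (suc i) (s≤s z≤n))
    where
    module C₁ = Coordinates D₁ a₁ b₁ I₁
    module C₂ = Coordinates D₂ a₁ b₁ I₂
    same-cX : ∀ i → i < e → cX (row D₁) b₁ (suc i) ≡ cX (row D₂) b₁ (suc i)
    same-cX i i<e = ℤ.+-injective (trans (sym (C₁.xv≡cX i i<e)) (trans (cong (λ v → at (proj₁ v) (suc i)) Ψ≡) (C₂.xv≡cX i i<e)))
    same-cY : ∀ i → i < e → cY (row D₁) a₁ (length D₁) (suc i) ≡ cY (row D₂) a₁ (length D₂) (suc i)
    same-cY i i<e = ℤ.+-injective (trans (sym (C₁.yv≡cY i i<e)) (trans (cong (λ v → at (proj₁ (proj₂ v)) (suc i)) Ψ≡) (C₂.yv≡cY i i<e)))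

  module Realise (xv yv : Vec ℤ e) (z : ℤ) (inP : InP d (xv , yv , z)) (a b : ℕ) (min≡μ : a ⊓ b ≡ μ) (diff : + b - + a ≡ z) where

    X Y : ℕ → ℕ
    X i = ℤ.∣ at xv i ∣
    Y i = ℤ.∣ at yv i ∣

    xv≡X : ∀ i → i < e → at xv (suc i) ≡ + X (suc i)
    xv≡X i i<e = sym (ℤ.0≤i⇒+∣i∣≡i (proj₁ (proj₁ (proj₂ inP) (suc i) (s≤s z≤n) i<e)))

    yv≡Y : ∀ i → i < e → at yv (suc i) ≡ + Y (suc i)
    yv≡Y i i<e = sym (ℤ.0≤i⇒+∣i∣≡i (proj₂ (proj₁ (proj₂ inP) (suc i) (s≤s z≤n) i<e)))

    X-antitone : ∀ i → suc i < e → X (suc (suc i)) ≤ X (suc i)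
    X-antitone i 2+i≤e = ℤ.drop‿+≤+ (subst₂ ℤ._≤_ (xv≡X (suc i) 2+i≤e) (xv≡X i (<-trans (n<1+n i) 2+i≤e))
                                             (proj₁ (proj₁ inP (suc i) (s≤s z≤n) (∸-monoˡ-≤ 1 2+i≤e))))

    Y-antitone : ∀ i → suc i < e → Y (suc (suc i)) ≤ Y (suc i)
    Y-antitone i 2+i≤e = ℤ.drop‿+≤+ (subst₂ ℤ._≤_ (yv≡Y (suc i) 2+i≤e) (yv≡Y i (<-trans (n<1+n i) 2+i≤e))
                                             (proj₂ (proj₁ inP (suc i) (s≤s z≤n) (∸-monoˡ-≤ 1 2+i≤e))))

    open FromCounts X Y (≤-trans d≤μ (proj₁ (⊓≡⇒≤ min≡μ))) (≤-trans d≤μ (proj₂ (⊓≡⇒≤ min≡μ)))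
                    X-antitone Y-antitone public

    xv≡cX : ∀ i → i < e → at xv (suc i) ≡ + cX (row D) b (suc i)
    xv≡cX i i<e = trans (xv≡X i i<e) (cong +_ (sym (cX-D i i<e)))

    yv≡cY : ∀ i → i < e → at yv (suc i) ≡ + cY (row D) a N (suc i)
    yv≡cY i i<e = trans (yv≡Y i i<e) (cong +_ (sym (cY-D i i<e)))

    open 𝔓Conditions shape xv yv xv≡cX yv≡cY using (νs; E; inequality⇔ν₀≤ν; equation⇔νlast≡ν₀)

    νs≡ν : ∀ j → νs j ≡ ν d j D
    νs≡ν j = sym (ν≡νᶠ d j D N length-D)

    νlast≡ν₀ : ν d (suc e) D ≡ ν d 0 D
    νlast≡ν₀ = trans (sym (νs≡ν (suc e))) (trans (Equivalence.to equation⇔νlast≡ν₀ equation) (νs≡ν 0))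
      where
      equation : sumℤ (toList yv) - sumℤ (toList xv) ≡ (+ b - + a) ℤ.* + suc e
      equation = subst (λ w → sumℤ (toList yv) - sumℤ (toList xv) ≡ w ℤ.* + suc e) (sym diff) (proj₂ (proj₂ (proj₂ inP)))

    ν₀≤ν : ∀ j → j < d → ν d 0 D ≤ ν d j D
    ν₀≤ν zero    _     = ≤-refl
    ν₀≤ν (suc j) 1+j<d with suc j ≤? e
    ... | yes 1+j≤e = subst₂ _≤_ (νs≡ν 0) (νs≡ν (suc j)) (Equivalence.to (inequality⇔ν₀≤ν j 1+j≤e) inequality)
      where
      inequality : + 0 ℤ.≤ E (+ b - + a) (suc j)
      inequality = subst (λ w → + 0 ℤ.≤ E w (suc j)) (sym diff) (proj₁ (proj₂ (proj₂ inP)) (suc j) (s≤s z≤n) 1+j≤e)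
    ... | no  1+j≰e = ≤-reflexive (trans (sym νlast≡ν₀) (cong (λ k → ν d k D) (≤-antisym (≰⇒> 1+j≰e) (s≤s⁻¹ 1+j<d))))

    ν₀≡νmin : ν d 0 D ≡ νmin d D
    ν₀≡νmin = ≤-antisym (νmin-greatest d D _ z<s ν₀≤ν) (νmin-≤ d D 0 z<s)

    inIrr : InIrr d μ D a b
    inIrr = ferrers , extremes-minimal⇒irreducible shape ν₀≡νmin (trans νlast≡ν₀ ν₀≡νmin) , shape⇒standardForm shape , min≡μ

    Ψ≡ : Ψ d D a b ≡ (xv , yv , z)
    Ψ≡ = cong₂ _,_ (tabulate-at _ xv (λ i i<e → trans (cong +_ (cX-count e D b i i<e)) (sym (xv≡cX i i<e))))
                   (cong₂ _,_ (tabulate-at _ yv (λ i i<e → trans (cong +_ (cY-count e D a N i length-D (StandardShape.a≤N shape) i<e)) (sym (yv≡cY i i<e))))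
                              diff)

  Ψ-surjective : ∀ v → InP d v → Σ Diagram (λ D → Σ ℕ (λ a → Σ ℕ (λ b → InIrr d μ D a b × Ψ d D a b ≡ v)))
  Ψ-surjective (xv , yv , z) inP with minDiff-surjective μ z
  ... | a , b , min≡μ , diff = D , a , b , inIrr , Ψ≡
    where open Realise xv yv z inP a b min≡μ diff

theorem5p13 : (d μ : ℕ) → 3 ≤ d → d ≤ μ →
    ((D : Diagram) (a b : ℕ) → InIrr d μ D a b → InP d (Ψ d D a b)) ×
    ((D : Diagram) (a b a' b' : ℕ) → InIrr d μ D a b → InIrr d μ D a' b' → Ψ d D a b ≡ Ψ d D a' b') ×
    ((D₁ D₂ : Diagram) (a₁ b₁ a₂ b₂ : ℕ) → InIrr d μ D₁ a₁ b₁ → InIrr d μ D₂ a₂ b₂ →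
      Ψ d D₁ a₁ b₁ ≡ Ψ d D₂ a₂ b₂ → D₁ ≡ D₂) ×
    ((v : Point d) → InP d v →
      Σ Diagram (λ D → Σ ℕ (λ a → Σ ℕ (λ b → InIrr d μ D a b × Ψ d D a b ≡ v))))
-- The argument only needs d ≥ 2.
theorem5p13 (suc (suc e)) μ (s≤s (s≤s _)) d≤μ =
  Ψ-in-𝔓 d≤μ , Ψ-well-defined d≤μ , Ψ-injective d≤μ , Ψ-surjective d≤μ
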